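{- Let $k\geq1$, $e\in\{0,\ldots,k\}$ and $x\in D_{2k}^e$. Let $U_x$ be the set of positions of up-steps of $x$ that lie below the line $y=0$, and let $D_x$ be the set of positions of down-steps of $x$ that lie below the line $y=-1$ or that are among the first $d_0(x)$ (from the left) down-steps of $x$ touching the line $y=0$. Let $x^0\in D_{2k}^0$ be such that $f^e(x^0)=x$. Then $x^0$ and $x$ differ exactly in the positions $U_x\cup D_x$; in particular $|U_x|=|D_x|=e$.
   Context: A lattice path with $n$ steps is a sequence $x=(x_1,\ldots,x_n)$ of steps, each either an up-step $(1,1)$ or a down-step $(1,-1)$, drawn in $\mathbb{Z}^2$ starting at the origin; step $x_i$ (at position $i$) goes from $(i-1,h_{i-1})$ to $(i,h_i)$. A step lies below the line $y=c$ if both of its endpoints have $y$-coordinate at most $c$. A step touches the line $y=c$ if it starts or ends on that line. For $c\in\mathbb{Z}$, $u_c(x)$ and $d_c(x)$ denote the number of up-steps, respectively down-steps, of $x$ that start on the line $y=c$. Let $L_{2k,k}$ (resp. $L_{2k,k+1}$) be the set of lattice paths with $2k$ steps of which exactly $k$ (resp. $k+1$) are up-steps. $D_{2k}^e$ is the set of paths in $L_{2k,k}$ having exactly $e$ down-steps below the line $y=0$. For $x\in L_{2k,k}\setminus D_{2k}^k$, $g(x)$ is obtained from $x$ by replacing by an up-step the $(d_0(x)+1)$-th (from the left) down-step of $x$ touching the line $y=0$. For $x'\in L_{2k,k+1}$, $h(x')$ is obtained from $x'$ by replacing by a down-step the $u_1(x')$-th (from the left) up-step of $x'$ touching the line $y=1$.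 $f(x):=h(g(x))$; it is a bijection from $D_{2k}^{e}$ to $D_{2k}^{e+1}$ for $e<k$, so $x^0$ exists and is unique. -}

module Defs where

open import Data.Bool.Base using (Bool; true; false; not; _∧_; _∨_; _xor_)
open import Data.Nat.Base using (ℕ; zero; suc; _*_)
open import Data.Integer.Base using (ℤ; +_; -_; _+_)
open import Data.Integer.Properties using (_≟_; _≤?_)
open import Data.Fin.Base using (Fin; zero; suc)
open import Data.Fin.Subset using (Subset; _∪_; ∣_∣)
open import Data.Vec.Base using (Vec; []; _∷_; lookup; tabulate; zipWith; _[_]≔_)
open import Data.Maybe.Base using (Maybe; just; nothing; _>>=_)
import Data.Maybe.Base as Maybe
open import Data.Product.Base using (_×_)
open import Relation.Nullary.Decidable.Core using (does)
open import Relation.Binary.PropositionalEquality using (_≡_)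

-- A lattice path with n steps: true = up-step (1,1), false = down-step (1,-1).
-- Positions are 0-based (Fin n): position i here is the paper's position i+1.
Path : ℕ → Set
Path n = Vec Bool n

stepH : Bool → ℤ
stepH true  = + 1
stepH false = - (+ 1)

startsFrom : ∀ {n} → ℤ → Path n → Vec ℤ n
startsFrom h []       = []
startsFrom h (b ∷ bs) = h ∷ startsFrom (h + stepH b) bs

startH : ∀ {n} → Path n → Fin n → ℤ
startH x i = lookup (startsFrom (+ 0) x) i

endH : ∀ {n} → Path n → Fin n → ℤ
endH x i = startH x i + stepH (lookup x i)

isUp : ∀ {n} → Path n → Fin n → Bool
isUp x i = lookup x i

isDown : ∀ {n} → Path n → Fin n → Bool
isDown x i = not (lookup x i)

below : ∀ {n} → ℤ → Path n → Fin n → Bool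
below c x i = does (startH x i ≤? c) ∧ does (endH x i ≤? c)

touches : ∀ {n} → ℤ → Path n → Fin n → Bool
touches c x i = does (startH x i ≟ c) ∨ does (endH x i ≟ c)

startsOn : ∀ {n} → ℤ → Path n → Fin n → Bool
startsOn c x i = does (startH x i ≟ c)

numUp : ∀ {n} → Path n → ℕ
numUp x = ∣ x ∣

u : ∀ {n} → ℤ → Path n → ℕ
u c x = ∣ tabulate (λ i → isUp x i ∧ startsOn c x i) ∣

d : ∀ {n} → ℤ → Path n → ℕ
d c x = ∣ tabulate (λ i → isDown x i ∧ startsOn c x i) ∣

downBelow : ∀ {n} → ℤ → Path n → Subset n
downBelow c x = tabulate (λ i → isDown x i ∧ below c x i)

upBelow : ∀ {n} → ℤ → Path n → Subset n
upBelow c x = tabulate (λ i → isUp x i ∧ below c x i)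

downTouch : ∀ {n} → ℤ → Path n → Subset n
downTouch c x = tabulate (λ i → isDown x i ∧ touches c x i)

upTouch : ∀ {n} → ℤ → Path n → Subset n
upTouch c x = tabulate (λ i → isUp x i ∧ touches c x i)

-- the j-th (0-based, from the left) element of a subset, if it exists
nthPos : ∀ {n} → Subset n → ℕ → Maybe (Fin n)
nthPos []            j       = nothing
nthPos (true  ∷ s)   zero    = just zero
nthPos (true  ∷ s)   (suc j) = Maybe.map suc (nthPos s j)
nthPos (false ∷ s)   j       = Maybe.map suc (nthPos s j)

firstN : ∀ {n} → Subset n → ℕ → Subset n
firstN []          m       = []
firstN (true  ∷ s) zero    = false ∷ firstN s zero
firstN (true  ∷ s) (suc m) = true ∷ firstN s m
firstN (false ∷ s) m       = false ∷ firstN s m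

InL : (k : ℕ) → Path (2 * k) → Set
InL k x = numUp x ≡ k

InD : (k e : ℕ) → Path (2 * k) → Set
InD k e x = InL k x × ∣ downBelow (+ 0) x ∣ ≡ e

-- g: replace by an up-step the (d_0(x)+1)-th down-step touching y=0
-- (nothing if that step does not exist; g is only defined there in the paper)
g : ∀ {n} → Path n → Maybe (Path n)
g x = Maybe.map (λ i → x [ i ]≔ true) (nthPos (downTouch (+ 0) x) (d (+ 0) x))

h : ∀ {n} → Path n → Maybe (Path n)
h x' with u (+ 1) x'
... | zero  = nothing
... | suc j = Maybe.map (λ i → x' [ i ]≔ false) (nthPos (upTouch (+ 1) x') j)

f : ∀ {n} → Path n → Maybe (Path n)
f x = g x >>= h

iterM : ∀ {A : Set} → ℕ → (A → Maybe A) → A → Maybe A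
iterM zero    φ a = just a
iterM (suc e) φ a = iterM e φ a >>= φ

Ux : ∀ {n} → Path n → Subset n
Ux x = upBelow (+ 0) x

Dx : ∀ {n} → Path n → Subset n
Dx x = downBelow (- (+ 1)) x ∪ firstN (downTouch (+ 0) x) (d (+ 0) x)

diffPos : ∀ {n} → Path n → Path n → Subset n
diffPos x y = zipWith _xor_ x y

-- A balanced path is a sequence of excursions, each a plane forest lifted above the axis
-- (positive) or reflected below it (negative). Every excursion has exactly one down-step
-- touching 0, and d₀(x) is the number of negative excursions, so g raises a step of the
-- (d₀+1)-th excursion; h then lowers the root step of the last tree of the nearest positive
-- excursion at or before it, and the result is again a sequence of excursions.
-- Let Φ(x) flip, in the first d₀(x) excursions, the last step of the positive and every step of
-- the negative ones, and in the later excursions every step but the first of the negative ones.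
-- Then Φ(x) = x xor (U_x ∪ D_x), Φ is invariant under f and Φ is the identity on D⁰, so Φ(x) = x⁰.
-- Counting inside each negative excursion gives |U_x| = |D_x| = (down-steps of x below 0) = e.

module Submission where

open import Defs
import Data.Bool.Properties as Bool
open import Data.Bool.Base using (Bool; true; false; not; _∧_; _∨_; _xor_)
open import Data.Nat.Base using (ℕ; zero; suc; _+_; _*_; _∸_; _≤_; _<ᵇ_; s≤s; z≤n)
open import Data.Integer.Base as ℤ using (ℤ; +_; -[1+_]; -_)
import Data.Integer.Properties as ℤ
import Data.Nat.Properties as ℕ
open import Data.List.Base as List using (List; []; _∷_; _++_; _∷ʳ_; length; map)
import Data.List.Properties as List
open import Data.Vec.Base as Vec using (Vec; toList; tabulate; lookup)
open import Data.Maybe.Base as Maybe using (Maybe; just; nothing; _>>=_)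
open import Data.Fin.Subset using (_∪_; ∣_∣)
open import Relation.Binary.PropositionalEquality
open import Relation.Nullary.Decidable.Core using (does)
open import Data.List.Reverse using (reverseView; []; _∶_∶ʳ_)
open import Tactic.MonoidSolver using (solve)
open import Data.Nat.Tactic.RingSolver using (solve-∀)
open import Data.Unit.Base using (⊤; tt)
open import Data.Empty using (⊥; ⊥-elim)
open import Data.Sum.Base using (_⊎_; inj₁; inj₂)
import Data.Maybe.Properties as Maybe
import Data.Vec.Properties as Vec
open import Data.Product.Base using (∃; ∃₂; _×_; _,_)

cong₃ : ∀ {A B C D : Set} (φ : A → B → C → D) {a a′ b b′ c c′} →
  a ≡ a′ → b ≡ b′ → c ≡ c′ → φ a b c ≡ φ a′ b′ c′
cong₃ φ refl refl refl = refl

splitAt : ∀ {A : Set} n (xs : List A) → length xs ≤ n ⊎ ∃₂ λ pre x → ∃ λ rest → xs ≡ pre ++ x ∷ rest × length pre ≡ n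
splitAt n       []       = inj₁ z≤n
splitAt zero    (x ∷ xs) = inj₂ ([] , x , xs , refl , refl)
splitAt (suc n) (x ∷ xs) with splitAt n xs
... | inj₁ le                             = inj₁ (s≤s le)
... | inj₂ (pre , y , rest , refl , refl) = inj₂ (x ∷ pre , y , rest , refl , refl)

zipWith-++ : ∀ {A B C : Set} (_•_ : A → B → C) xs xs′ ys ys′ → length xs ≡ length ys →
  List.zipWith _•_ (xs ++ xs′) (ys ++ ys′) ≡ List.zipWith _•_ xs ys ++ List.zipWith _•_ xs′ ys′
zipWith-++ _•_ []       xs′ []       ys′ _   = refl
zipWith-++ _•_ (x ∷ xs) xs′ (y ∷ ys) ys′ len = cong ((x • y) ∷_) (zipWith-++ _•_ xs xs′ ys ys′ (ℕ.suc-injective len))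

length-zipWith : ∀ {A B C : Set} (_•_ : A → B → C) xs ys → length xs ≡ length ys → length (List.zipWith _•_ xs ys) ≡ length xs
length-zipWith _•_ []       []       _   = refl
length-zipWith _•_ (x ∷ xs) (y ∷ ys) len = cong suc (length-zipWith _•_ xs ys (ℕ.suc-injective len))

zipWith-wrap : ∀ {A B C : Set} (_•_ : A → B → C) a l b a′ l′ b′ → length l ≡ length l′ →
  List.zipWith _•_ (a ∷ l ++ b ∷ []) (a′ ∷ l′ ++ b′ ∷ []) ≡ (a • a′) ∷ List.zipWith _•_ l l′ ++ (b • b′) ∷ []
zipWith-wrap _•_ a l b a′ l′ b′ len = cong ((a • a′) ∷_) (zipWith-++ _•_ l (b ∷ []) l′ (b′ ∷ []) len)

xor-cancel : ∀ l s → length l ≡ length s → List.zipWith _xor_ (List.zipWith _xor_ l s) l ≡ s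
xor-cancel []      []      _   = refl
xor-cancel (a ∷ l) (b ∷ s) len = cong₂ _∷_ (cancel a b) (xor-cancel l s (ℕ.suc-injective len))
  where
  cancel : ∀ a b → (a xor b) xor a ≡ b
  cancel true  true  = refl
  cancel true  false = refl
  cancel false true  = refl
  cancel false false = refl

map-not-involutive : ∀ l → map not (map not l) ≡ l
map-not-involutive l = trans (sym (List.map-∘ l)) (trans (List.map-cong Bool.not-involutive l) (List.map-id l))

blank : ∀ {A : Set} → List A → List Bool
blank = map (λ _ → false)

length-blank : ∀ {A : Set} (l : List A) → length (blank l) ≡ length l
length-blank = List.length-map _

∨-blank : ∀ l → List.zipWith _∨_ l (blank l) ≡ l
∨-blank []          = refl
∨-blank (true ∷ l)  = cong (true ∷_) (∨-blank l)
∨-blank (false ∷ l) = cong (false ∷_) (∨-blank l)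

blank-∨-blank : ∀ {A : Set} (l : List A) → List.zipWith _∨_ (blank l) (blank l) ≡ blank l
blank-∨-blank []      = refl
blank-∨-blank (_ ∷ l) = cong (false ∷_) (blank-∨-blank l)

not-∨ : ∀ l → List.zipWith _∨_ (map not l) l ≡ map (λ _ → true) l
not-∨ []          = refl
not-∨ (true ∷ l)  = cong (true ∷_) (not-∨ l)
not-∨ (false ∷ l) = cong (true ∷_) (not-∨ l)

xor-blank : ∀ l → List.zipWith _xor_ l (blank l) ≡ l
xor-blank []          = refl
xor-blank (true ∷ l)  = cong (true ∷_) (xor-blank l)
xor-blank (false ∷ l) = cong (false ∷_) (xor-blank l)

not-xor-true : ∀ l → List.zipWith _xor_ (map not l) (map (λ _ → true) l) ≡ l
not-xor-true []          = refl
not-xor-true (true ∷ l)  = cong (true ∷_) (not-xor-true l)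
not-xor-true (false ∷ l) = cong (false ∷_) (not-xor-true l)

trues : List Bool → ℕ
trues []          = 0
trues (true ∷ l)  = suc (trues l)
trues (false ∷ l) = trues l

falses : List Bool → ℕ
falses l = trues (map not l)

trues-++ : ∀ l l′ → trues (l ++ l′) ≡ trues l + trues l′
trues-++ []          l′ = refl
trues-++ (true ∷ l)  l′ = cong suc (trues-++ l l′)
trues-++ (false ∷ l) l′ = trues-++ l l′

falses-++ : ∀ l l′ → falses (l ++ l′) ≡ falses l + falses l′
falses-++ l l′ = trans (cong trues (List.map-++ not l l′)) (trues-++ (map not l) (map not l′))

trues-++₃ : ∀ l l′ l″ → trues (l ++ l′ ++ l″) ≡ trues l + (trues l′ + trues l″)
trues-++₃ l l′ l″ = trans (trues-++ l (l′ ++ l″)) (cong (λ n → trues l + n) (trues-++ l′ l″))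

trues-blank : ∀ {A : Set} (l : List A) → trues (blank l) ≡ 0
trues-blank []      = refl
trues-blank (_ ∷ l) = trues-blank l

trues+falses : ∀ l → trues l + falses l ≡ length l
trues+falses []          = refl
trues+falses (true ∷ l)  = cong suc (trues+falses l)
trues+falses (false ∷ l) = trans (ℕ.+-suc (trues l) (falses l)) (cong suc (trues+falses l))

falses-map-not : ∀ l → falses (map not l) ≡ trues l
falses-map-not l = cong trues (map-not-involutive l)

trues-wrap : ∀ a l b → trues (a ∷ l ++ b ∷ []) ≡ trues l + trues (a ∷ b ∷ [])
trues-wrap true  l b = trans (cong suc (trues-++ l (b ∷ []))) (sym (ℕ.+-suc (trues l) (trues (b ∷ []))))
trues-wrap false l b = trues-++ l (b ∷ [])

trues-wrap-blank : ∀ {A : Set} a (l : List A) b → trues (a ∷ blank l ++ b ∷ []) ≡ trues (a ∷ b ∷ [])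
trues-wrap-blank a l b = trans (trues-wrap a (blank l) b) (cong (_+ trues (a ∷ b ∷ [])) (trues-blank l))

length-wrap : ∀ {A B : Set} (a : A) l (b : A) (a′ : B) l′ (b′ : B) → length l ≡ length l′ →
  length (a ∷ l ++ b ∷ []) ≡ length (a′ ∷ l′ ++ b′ ∷ [])
length-wrap a l b a′ l′ b′ eq = cong suc (trans (List.length-++ l) (trans (cong (_+ 1) eq) (sym (List.length-++ l′))))

marks : (ℤ → Bool → Bool) → ℤ → List Bool → List Bool
marks P a []       = []
marks P a (b ∷ bs) = P a b ∷ marks P (a ℤ.+ stepH b) bs

endHeight : ℤ → List Bool → ℤ
endHeight a []       = a
endHeight a (b ∷ bs) = endHeight (a ℤ.+ stepH b) bs

marks-++ : ∀ P a l l′ → marks P a (l ++ l′) ≡ marks P a l ++ marks P (endHeight a l) l′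
marks-++ P a []      l′ = refl
marks-++ P a (b ∷ l) l′ = cong (P a b ∷_) (marks-++ P (a ℤ.+ stepH b) l l′)

endHeight-++ : ∀ a l l′ → endHeight a (l ++ l′) ≡ endHeight (endHeight a l) l′
endHeight-++ a []      l′ = refl
endHeight-++ a (b ∷ l) l′ = endHeight-++ (a ℤ.+ stepH b) l l′

length-marks : ∀ P a l → length (marks P a l) ≡ length l
length-marks P a []      = refl
length-marks P a (b ∷ l) = cong suc (length-marks P (a ℤ.+ stepH b) l)

mirror : (ℤ → Bool → Bool) → ℤ → Bool → Bool
mirror P s b = P (- s) (not b)

stepH-not : ∀ b → stepH (not b) ≡ - stepH b
stepH-not true  = refl
stepH-not false = refl

marks-map-not : ∀ P a l → marks P (- a) (map not l) ≡ marks (mirror P) a l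
marks-map-not P a []      = refl
marks-map-not P a (b ∷ l) = cong (P (- a) (not b) ∷_) (begin
  marks P (- a ℤ.+ stepH (not b)) (map not l) ≡⟨ cong (λ s → marks P (- a ℤ.+ s) (map not l)) (stepH-not b) ⟩
  marks P (- a ℤ.+ - stepH b) (map not l)     ≡⟨ cong (λ s → marks P s (map not l)) (sym (ℤ.neg-distrib-+ a (stepH b))) ⟩
  marks P (- (a ℤ.+ stepH b)) (map not l)     ≡⟨ marks-map-not P (a ℤ.+ stepH b) l ⟩
  marks (mirror P) (a ℤ.+ stepH b) l          ∎)
  where open ≡-Reasoning

endHeight-map-not : ∀ a l → endHeight (- a) (map not l) ≡ - endHeight a l
endHeight-map-not a []      = refl
endHeight-map-not a (b ∷ l) = begin
  endHeight (- a ℤ.+ stepH (not b)) (map not l) ≡⟨ cong (λ s → endHeight (- a ℤ.+ s) (map not l)) (stepH-not b) ⟩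
  endHeight (- a ℤ.+ - stepH b) (map not l)     ≡⟨ cong (λ s → endHeight s (map not l)) (sym (ℤ.neg-distrib-+ a (stepH b))) ⟩
  endHeight (- (a ℤ.+ stepH b)) (map not l)     ≡⟨ endHeight-map-not (a ℤ.+ stepH b) l ⟩
  - endHeight (a ℤ.+ stepH b) l                 ∎
  where open ≡-Reasoning

setMarked : ∀ {A : Set} → List Bool → ℕ → A → List A → Maybe (List A)
setMarked []          j       c x        = nothing
setMarked (_ ∷ m)     j       c []       = nothing
setMarked (true ∷ m)  zero    c (_ ∷ x)  = just (c ∷ x)
setMarked (true ∷ m)  (suc j) c (y ∷ x)  = Maybe.map (y ∷_) (setMarked m j c x)
setMarked (false ∷ m) j       c (y ∷ x)  = Maybe.map (y ∷_) (setMarked m j c x)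

setMarked-skip : ∀ {A : Set} m₁ (x₁ : List A) {m₂ x₂ j c z} → length m₁ ≡ length x₁ → setMarked m₂ j c x₂ ≡ just z →
  setMarked (m₁ ++ m₂) (trues m₁ + j) c (x₁ ++ x₂) ≡ just (x₁ ++ z)
setMarked-skip []          []      _   eq = eq
setMarked-skip (true ∷ m₁)  (y ∷ x₁) len eq = cong (Maybe.map (y ∷_)) (setMarked-skip m₁ x₁ (ℕ.suc-injective len) eq)
setMarked-skip (false ∷ m₁) (y ∷ x₁) len eq = cong (Maybe.map (y ∷_)) (setMarked-skip m₁ x₁ (ℕ.suc-injective len) eq)

setMarked-here : ∀ {A : Set} m₁ (x₁ : List A) {m₂ x₂ j c z} → setMarked m₁ j c x₁ ≡ just z →
  setMarked (m₁ ++ m₂) j c (x₁ ++ x₂) ≡ just (z ++ x₂)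
setMarked-here (true ∷ m₁) (y ∷ x₁) {j = zero} refl = refl
setMarked-here (true ∷ m₁) (y ∷ x₁) {j = suc j} {c} eq with setMarked m₁ j c x₁ in eq₁
... | just _ = trans (cong (Maybe.map (y ∷_)) (setMarked-here m₁ x₁ eq₁)) (cong (Maybe.map (_++ _)) eq)
setMarked-here (false ∷ m₁) (y ∷ x₁) {j = j} {c} eq with setMarked m₁ j c x₁ in eq₁
... | just _ = trans (cong (Maybe.map (y ∷_)) (setMarked-here m₁ x₁ eq₁)) (cong (Maybe.map (_++ _)) eq)

setMarked-beyond : ∀ {A : Set} m {j} {c : A} {x} → trues m ≤ j → setMarked m j c x ≡ nothing
setMarked-beyond []                                   _         = refl
setMarked-beyond (_ ∷ m)     {x = []}                 _         = refl
setMarked-beyond (true ∷ m)  {suc j} {x = y ∷ _} (s≤s le) = cong (Maybe.map (y ∷_)) (setMarked-beyond m le)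
setMarked-beyond (false ∷ m) {x = y ∷ _}         le       = cong (Maybe.map (y ∷_)) (setMarked-beyond m le)

setMarked-blank : ∀ {A : Set} (l : List A) {m j c x z} → setMarked m j c x ≡ just z →
  setMarked (blank l ++ m) j c (l ++ x) ≡ just (l ++ z)
setMarked-blank []      eq = eq
setMarked-blank (y ∷ l) eq = cong (Maybe.map (y ∷_)) (setMarked-blank l eq)

firstMarked : List Bool → ℕ → List Bool
firstMarked []          k       = []
firstMarked (true ∷ m)  zero    = false ∷ firstMarked m zero
firstMarked (true ∷ m)  (suc k) = true ∷ firstMarked m k
firstMarked (false ∷ m) k       = false ∷ firstMarked m k

firstMarked-++ : ∀ m m′ k → firstMarked (m ++ m′) k ≡ firstMarked m k ++ firstMarked m′ (k ∸ trues m)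
firstMarked-++ []          m′ k       = refl
firstMarked-++ (true ∷ m)  m′ zero    =
  cong (false ∷_) (trans (firstMarked-++ m m′ zero) (cong (λ i → firstMarked m zero ++ firstMarked m′ i) (ℕ.0∸n≡0 (trues m))))
firstMarked-++ (true ∷ m)  m′ (suc k) = cong (true ∷_) (firstMarked-++ m m′ k)
firstMarked-++ (false ∷ m) m′ k       = cong (false ∷_) (firstMarked-++ m m′ k)

firstMarked-blank : ∀ {A : Set} (l : List A) m k → firstMarked (blank l ++ m) k ≡ blank l ++ firstMarked m k
firstMarked-blank []      m k = refl
firstMarked-blank (_ ∷ l) m k = cong (false ∷_) (firstMarked-blank l m k)

length-firstMarked : ∀ m k → length (firstMarked m k) ≡ length m
length-firstMarked []          k       = refl
length-firstMarked (true ∷ m)  zero    = cong suc (length-firstMarked m zero)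
length-firstMarked (true ∷ m)  (suc k) = cong suc (length-firstMarked m k)
length-firstMarked (false ∷ m) k       = cong suc (length-firstMarked m k)

upBelowᵖ downBelowᵖ upTouchᵖ downTouchᵖ upStartᵖ downStartᵖ : ℤ → ℤ → Bool → Bool
upBelowᵖ   c s b = b ∧ (does (s ℤ.≤? c) ∧ does ((s ℤ.+ stepH b) ℤ.≤? c))
downBelowᵖ c s b = not b ∧ (does (s ℤ.≤? c) ∧ does ((s ℤ.+ stepH b) ℤ.≤? c))
upTouchᵖ   c s b = b ∧ (does (s ℤ.≟ c) ∨ does ((s ℤ.+ stepH b) ℤ.≟ c))
downTouchᵖ c s b = not b ∧ (does (s ℤ.≟ c) ∨ does ((s ℤ.+ stepH b) ℤ.≟ c))
upStartᵖ   c s b = b ∧ does (s ℤ.≟ c)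
downStartᵖ c s b = not b ∧ does (s ℤ.≟ c)

d₀ˡ u₁ˡ : List Bool → ℕ
d₀ˡ l = trues (marks (downStartᵖ (+ 0)) (+ 0) l)
u₁ˡ l = trues (marks (upStartᵖ (+ 1)) (+ 0) l)

gˡ : List Bool → Maybe (List Bool)
gˡ l = setMarked (marks (downTouchᵖ (+ 0)) (+ 0) l) (d₀ˡ l) true l

lowerUpTouch₁ : ℕ → List Bool → Maybe (List Bool)
lowerUpTouch₁ zero    l = nothing
lowerUpTouch₁ (suc j) l = setMarked (marks (upTouchᵖ (+ 1)) (+ 0) l) j false l

hˡ fˡ : List Bool → Maybe (List Bool)
hˡ l = lowerUpTouch₁ (u₁ˡ l) l
fˡ l = gˡ l >>= hˡ

Dset : ℕ → List Bool → List Bool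
Dset k l = List.zipWith _∨_ (marks (downBelowᵖ -[1+ 0 ]) (+ 0) l) (firstMarked (marks (downTouchᵖ (+ 0)) (+ 0) l) k)

Uˡ Dˡ : List Bool → List Bool
Uˡ l = marks (upBelowᵖ (+ 0)) (+ 0) l
Dˡ l = Dset (d₀ˡ l) l

flipSet : ℕ → List Bool → List Bool
flipSet k l = List.zipWith _∨_ (Uˡ l) (Dset k l)

iterˡ : ℕ → List Bool → Maybe (List Bool)
iterˡ zero    l = just l
iterˡ (suc e) l = iterˡ e l >>= fˡ

toList-tabulate-marks : ∀ {n} P a (x : Vec Bool n) →
  toList (tabulate (λ i → P (lookup (startsFrom a x) i) (lookup x i))) ≡ marks P a (toList x)
toList-tabulate-marks P a Vec.[]      = refl
toList-tabulate-marks P a (b Vec.∷ x) = cong (P a b ∷_) (toList-tabulate-marks P (a ℤ.+ stepH b) x)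

∣∣≡trues : ∀ {n} (v : Vec Bool n) → ∣ v ∣ ≡ trues (toList v)
∣∣≡trues Vec.[]          = refl
∣∣≡trues (true Vec.∷ v)  = cong suc (∣∣≡trues v)
∣∣≡trues (false Vec.∷ v) = ∣∣≡trues v

∣tabulate-marks∣ : ∀ {n} P a (x : Vec Bool n) →
  ∣ tabulate (λ i → P (lookup (startsFrom a x) i) (lookup x i)) ∣ ≡ trues (marks P a (toList x))
∣tabulate-marks∣ P a x =
  trans (∣∣≡trues (tabulate (λ i → P (lookup (startsFrom a x) i) (lookup x i)))) (cong trues (toList-tabulate-marks P a x))

toList-setMarked : ∀ {n} (m : Vec Bool n) j c (x : Vec Bool n) →
  Maybe.map toList (Maybe.map (λ i → x Vec.[ i ]≔ c) (nthPos m j)) ≡ setMarked (toList m) j c (toList x)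
toList-setMarked Vec.[]           j       c Vec.[]      = refl
toList-setMarked (true Vec.∷ m)  zero    c (y Vec.∷ x) = refl
toList-setMarked (true Vec.∷ m)  (suc j) c (y Vec.∷ x) rewrite sym (toList-setMarked m j c x) with nthPos m j
... | nothing = refl
... | just _  = refl
toList-setMarked (false Vec.∷ m) j       c (y Vec.∷ x) rewrite sym (toList-setMarked m j c x) with nthPos m j
... | nothing = refl
... | just _  = refl

toList-firstN : ∀ {n} (m : Vec Bool n) k → toList (firstN m k) ≡ firstMarked (toList m) k
toList-firstN Vec.[]          k       = refl
toList-firstN (true Vec.∷ m)  zero    = cong (false ∷_) (toList-firstN m zero)
toList-firstN (true Vec.∷ m)  (suc k) = cong (true ∷_) (toList-firstN m k)
toList-firstN (false Vec.∷ m) k       = cong (false ∷_) (toList-firstN m k)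

toList-zipWith : ∀ {n} (_•_ : Bool → Bool → Bool) (u v : Vec Bool n) →
  toList (Vec.zipWith _•_ u v) ≡ List.zipWith _•_ (toList u) (toList v)
toList-zipWith _•_ Vec.[]      Vec.[]      = refl
toList-zipWith _•_ (a Vec.∷ u) (b Vec.∷ v) = cong ((a • b) ∷_) (toList-zipWith _•_ u v)

d₀-toList : ∀ {n} (x : Path n) → d (+ 0) x ≡ d₀ˡ (toList x)
d₀-toList = ∣tabulate-marks∣ (downStartᵖ (+ 0)) (+ 0)

u₁-toList : ∀ {n} (x : Path n) → u (+ 1) x ≡ u₁ˡ (toList x)
u₁-toList = ∣tabulate-marks∣ (upStartᵖ (+ 1)) (+ 0)

toList-g : ∀ {n} (x : Path n) → Maybe.map toList (g x) ≡ gˡ (toList x)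
toList-g x rewrite d₀-toList x | sym (toList-tabulate-marks (downTouchᵖ (+ 0)) (+ 0) x) =
  toList-setMarked (downTouch (+ 0) x) _ true x

toList-h : ∀ {n} (x : Path n) → Maybe.map toList (h x) ≡ hˡ (toList x)
toList-h x rewrite sym (u₁-toList x) with u (+ 1) x
... | zero  = refl
... | suc j rewrite sym (toList-tabulate-marks (upTouchᵖ (+ 1)) (+ 0) x) = toList-setMarked (upTouch (+ 1) x) j false x

toList-f : ∀ {n} (x : Path n) → Maybe.map toList (f x) ≡ fˡ (toList x)
toList-f x with g x | toList-g x
... | nothing | eq rewrite sym eq = refl
... | just y  | eq rewrite sym eq = toList-h y

toList-iterM : ∀ {n} e (x : Path n) → Maybe.map toList (iterM e f x) ≡ iterˡ e (toList x)
toList-iterM zero    x = refl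
toList-iterM (suc e) x with iterM e f x | toList-iterM e x
... | nothing | eq rewrite sym eq = refl
... | just y  | eq rewrite sym eq = toList-f y

toList-Ux : ∀ {n} (x : Path n) → toList (Ux x) ≡ Uˡ (toList x)
toList-Ux = toList-tabulate-marks (upBelowᵖ (+ 0)) (+ 0)

toList-Dx : ∀ {n} (x : Path n) → toList (Dx x) ≡ Dˡ (toList x)
toList-Dx x = trans (toList-zipWith _∨_ _ _) (cong₂ (List.zipWith _∨_) (toList-tabulate-marks (downBelowᵖ -[1+ 0 ]) (+ 0) x)
  (trans (toList-firstN _ _) (cong₂ firstMarked (toList-tabulate-marks (downTouchᵖ (+ 0)) (+ 0) x) (d₀-toList x))))

balanced : ∀ k (x : Path (2 * k)) → InL k x → trues (toList x) ≡ falses (toList x)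
balanced k x ups = trans trues≡k (sym falses≡k)
  where
  trues≡k : trues (toList x) ≡ k
  trues≡k = trans (sym (∣∣≡trues x)) ups
  falses≡k : falses (toList x) ≡ k
  falses≡k = trans (ℕ.+-cancelˡ-≡ k _ _ (begin
    k + falses (toList x)                ≡⟨ cong (_+ falses (toList x)) (sym trues≡k) ⟩
    trues (toList x) + falses (toList x) ≡⟨ trues+falses (toList x) ⟩
    length (toList x)                    ≡⟨ Vec.length-toList x ⟩
    k + (k + 0)                          ∎)) (ℕ.+-identityʳ k)
    where open ≡-Reasoning

-- Plane forests and excursions

data Tree : Set where
  node : List Tree → Tree

mutual
  flatT : Tree → List Bool
  flatT (node ts) = true ∷ flatF ts ++ false ∷ []

  flatF : List Tree → List Bool
  flatF []       = []
  flatF (t ∷ ts) = flatT t ++ flatF ts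

data Excursion : Set where
  pos neg : List Tree → Excursion

flatE : Excursion → List Bool
flatE (pos ts) = flatT (node ts)
flatE (neg ts) = map not (flatT (node ts))

flatEs : List Excursion → List Bool
flatEs []       = []
flatEs (e ∷ es) = flatE e ++ flatEs es

flatE-neg : ∀ ts → flatE (neg ts) ≡ false ∷ map not (flatF ts) ++ true ∷ []
flatE-neg ts = cong (false ∷_) (List.map-++ not (flatF ts) (false ∷ []))

flatF-++ : ∀ ts ts′ → flatF (ts ++ ts′) ≡ flatF ts ++ flatF ts′
flatF-++ []       ts′ = refl
flatF-++ (t ∷ ts) ts′ = trans (cong (flatT t ++_) (flatF-++ ts ts′)) (sym (List.++-assoc (flatT t) (flatF ts) (flatF ts′)))

flatEs-++ : ∀ es es′ → flatEs (es ++ es′) ≡ flatEs es ++ flatEs es′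
flatEs-++ []       es′ = refl
flatEs-++ (e ∷ es) es′ = trans (cong (flatE e ++_) (flatEs-++ es es′)) (sym (List.++-assoc (flatE e) (flatEs es) (flatEs es′)))

asPos : Tree → Excursion
asPos (node ts) = pos ts

flatEs-asPos : ∀ ts → flatEs (map asPos ts) ≡ flatF ts
flatEs-asPos []             = refl
flatEs-asPos (node c ∷ ts) = cong (flatT (node c) ++_) (flatEs-asPos ts)

up-down : ∀ a → (a ℤ.+ + 1) ℤ.+ -[1+ 0 ] ≡ a
up-down a = trans (ℤ.+-assoc a (+ 1) -[1+ 0 ]) (ℤ.+-identityʳ a)

mutual
  endHeight-flatT : ∀ a t → endHeight a (flatT t) ≡ a
  endHeight-flatT a (node ts) = begin
    endHeight (a ℤ.+ + 1) (flatF ts ++ false ∷ [])        ≡⟨ endHeight-++ (a ℤ.+ + 1) (flatF ts) (false ∷ []) ⟩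
    endHeight (endHeight (a ℤ.+ + 1) (flatF ts)) (false ∷ []) ≡⟨ cong (λ s → endHeight s (false ∷ [])) (endHeight-flatF (a ℤ.+ + 1) ts) ⟩
    (a ℤ.+ + 1) ℤ.+ -[1+ 0 ]                              ≡⟨ up-down a ⟩
    a                                                     ∎
    where open ≡-Reasoning

  endHeight-flatF : ∀ a ts → endHeight a (flatF ts) ≡ a
  endHeight-flatF a []       = refl
  endHeight-flatF a (t ∷ ts) =
    trans (endHeight-++ a (flatT t) (flatF ts)) (trans (cong (λ s → endHeight s (flatF ts)) (endHeight-flatT a t)) (endHeight-flatF a ts))

endHeight-flatE : ∀ a e → endHeight a (flatE e) ≡ a
endHeight-flatE a (pos ts) = endHeight-flatT a (node ts)
endHeight-flatE a (neg ts) = begin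
  endHeight a (flatE (neg ts))              ≡⟨ cong (λ s → endHeight s (flatE (neg ts))) (sym (ℤ.neg-involutive a)) ⟩
  endHeight (- - a) (flatE (neg ts))        ≡⟨ endHeight-map-not (- a) (flatT (node ts)) ⟩
  - endHeight (- a) (flatT (node ts))       ≡⟨ cong -_ (endHeight-flatT (- a) (node ts)) ⟩
  - - a                                     ≡⟨ ℤ.neg-involutive a ⟩
  a                                         ∎
  where open ≡-Reasoning

endHeight-flatEs : ∀ a es → endHeight a (flatEs es) ≡ a
endHeight-flatEs a []       = refl
endHeight-flatEs a (e ∷ es) =
  trans (endHeight-++ a (flatE e) (flatEs es)) (trans (cong (λ s → endHeight s (flatEs es)) (endHeight-flatE a e)) (endHeight-flatEs a es))

marks-node : ∀ P a ts → marks P a (flatT (node ts)) ≡ P a true ∷ marks P (a ℤ.+ + 1) (flatF ts) ++ P (a ℤ.+ + 1) false ∷ []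
marks-node P a ts = cong (P a true ∷_) (trans (marks-++ P (a ℤ.+ + 1) (flatF ts) (false ∷ []))
  (cong (λ s → marks P (a ℤ.+ + 1) (flatF ts) ++ P s false ∷ []) (endHeight-flatF (a ℤ.+ + 1) ts)))

marks-flatF-∷ : ∀ P a t ts → marks P a (flatF (t ∷ ts)) ≡ marks P a (flatT t) ++ marks P a (flatF ts)
marks-flatF-∷ P a t ts =
  trans (marks-++ P a (flatT t) (flatF ts)) (cong (λ s → marks P a (flatT t) ++ marks P s (flatF ts)) (endHeight-flatT a t))

marks-flatEs-∷ : ∀ P a e es → marks P a (flatEs (e ∷ es)) ≡ marks P a (flatE e) ++ marks P a (flatEs es)
marks-flatEs-∷ P a e es =
  trans (marks-++ P a (flatE e) (flatEs es)) (cong (λ s → marks P a (flatE e) ++ marks P s (flatEs es)) (endHeight-flatE a e))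

marks-flatEs-++ : ∀ P a es es′ → marks P a (flatEs (es ++ es′)) ≡ marks P a (flatEs es) ++ marks P a (flatEs es′)
marks-flatEs-++ P a es es′ = trans (cong (marks P a) (flatEs-++ es es′)) (trans (marks-++ P a (flatEs es) (flatEs es′))
  (cong (λ s → marks P a (flatEs es) ++ marks P s (flatEs es′)) (endHeight-flatEs a es)))

marks-flatEs-prefix : ∀ P es l → marks P (+ 0) (flatEs es ++ l) ≡ marks P (+ 0) (flatEs es) ++ marks P (+ 0) l
marks-flatEs-prefix P es l =
  trans (marks-++ P (+ 0) (flatEs es) l) (cong (λ s → marks P (+ 0) (flatEs es) ++ marks P s l) (endHeight-flatEs (+ 0) es))

marks-flatE-prefix : ∀ P e l → marks P (+ 0) (flatE e ++ l) ≡ marks P (+ 0) (flatE e) ++ marks P (+ 0) l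
marks-flatE-prefix P e l = trans (marks-++ P (+ 0) (flatE e) l) (cong (λ s → marks P (+ 0) (flatE e) ++ marks P s l) (endHeight-flatE (+ 0) e))

-- Balanced paths are sequences of excursions

StaysNonneg : ℕ → List Bool → Set
StaysNonneg k       []          = ⊤
StaysNonneg k       (true ∷ w)  = StaysNonneg (suc k) w
StaysNonneg zero    (false ∷ w) = ⊥
StaysNonneg (suc k) (false ∷ w) = StaysNonneg k w

firstDescent : ∀ k l → trues l + suc k ≤ falses l →
  ∃₂ λ w r → l ≡ w ++ false ∷ r × StaysNonneg k w × trues w + k ≡ falses w
firstDescent k       (true ∷ l)  le with firstDescent (suc k) l (subst (_≤ falses l) (sym (ℕ.+-suc (trues l) (suc k))) le)
... | w , r , refl , nonneg , bal = true ∷ w , r , refl , nonneg , trans (sym (ℕ.+-suc (trues w) k)) bal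
firstDescent zero    (false ∷ l) le = [] , l , refl , tt , refl
firstDescent (suc k) (false ∷ l) le with firstDescent k l (ℕ.≤-pred (subst (_≤ suc (falses l)) (ℕ.+-suc (trues l) (suc k)) le))
... | w , r , refl , nonneg , bal = false ∷ w , r , refl , nonneg , trans (ℕ.+-suc (trues w) k) (cong suc bal)

StaysNonneg-suffix : ∀ k k′ w r → StaysNonneg k (w ++ r) → trues w + k ≡ falses w + k′ → StaysNonneg k′ r
StaysNonneg-suffix k       k′ []          r nonneg eq = subst (λ i → StaysNonneg i r) eq nonneg
StaysNonneg-suffix k       k′ (true ∷ w)  r nonneg eq = StaysNonneg-suffix (suc k) k′ w r nonneg (trans (ℕ.+-suc (trues w) k) eq)
StaysNonneg-suffix (suc k) k′ (false ∷ w) r nonneg eq =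
  StaysNonneg-suffix k k′ w r nonneg (ℕ.suc-injective (trans (sym (ℕ.+-suc (trues w) k)) eq))

balanced-after-descent : ∀ w r → trues w + 0 ≡ falses w →
  suc (trues (w ++ false ∷ r)) ≡ falses (w ++ false ∷ r) → trues r ≡ falses r
balanced-after-descent w r bal-w bal rewrite trues-++ w (false ∷ r) | falses-++ w (false ∷ r) | ℕ.+-identityʳ (trues w) | bal-w =
  ℕ.+-cancelˡ-≡ (falses w) _ _ (ℕ.suc-injective (trans bal (ℕ.+-suc (falses w) (falses r))))

length-split : ∀ {n} w r → length (w ++ false ∷ r) ≤ n → length w ≤ n × length r ≤ n
length-split w r le rewrite List.length-++ w {false ∷ r} =
  ℕ.≤-trans (ℕ.m≤m+n (length w) _) le , ℕ.≤-trans (ℕ.n≤1+n _) (ℕ.≤-trans (ℕ.m≤n+m (suc (length r)) (length w)) le)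

forestOf : ∀ n w → length w ≤ n → StaysNonneg 0 w → trues w ≡ falses w → ∃ λ ts → flatF ts ≡ w
forestOf n       []          _        _  _   = [] , refl
forestOf zero    (true ∷ w)  ()       _  _
forestOf (suc n) (true ∷ w)  (s≤s le) nonneg bal
  with firstDescent 0 w (ℕ.≤-reflexive (trans (ℕ.+-comm (trues w) 1) bal))
... | w₁ , r , refl , nonneg₁ , bal₁ with length-split w₁ r le
... | le₁ , le₂ with forestOf n w₁ le₁ nonneg₁ (trans (sym (ℕ.+-identityʳ (trues w₁))) bal₁)
                   | forestOf n r le₂ (StaysNonneg-suffix 1 1 w₁ (false ∷ r) nonneg (cong (_+ 1) (trans (sym (ℕ.+-identityʳ (trues w₁))) bal₁)))
                       (balanced-after-descent w₁ r bal₁ bal)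
... | ts₁ , refl | ts , refl = node ts₁ ∷ ts , cong (true ∷_) (List.++-assoc (flatF ts₁) (false ∷ []) (flatF ts))

firstReturn : ∀ n w → length w ≤ n → trues w + 1 ≡ falses w →
  ∃₂ λ ts r → w ≡ flatF ts ++ false ∷ r × length r ≤ n × trues r ≡ falses r
firstReturn n w le bal with firstDescent 0 w (ℕ.≤-reflexive bal)
... | w₁ , r , refl , nonneg₁ , bal₁ with length-split w₁ r le
... | le₁ , le₂ with forestOf n w₁ le₁ nonneg₁ (trans (sym (ℕ.+-identityʳ (trues w₁))) bal₁)
... | ts , refl = ts , r , refl , le₂ , balanced-after-descent (flatF ts) r bal₁ (trans (ℕ.+-comm 1 _) bal)

excursionsOf : ∀ n l → length l ≤ n → trues l ≡ falses l → ∃ λ es → flatEs es ≡ l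
excursionsOf n       []         _        _   = [] , refl
excursionsOf zero    (_ ∷ _)    ()       _
excursionsOf (suc n) (true ∷ w) (s≤s le) bal with firstReturn n w le (trans (ℕ.+-comm (trues w) 1) bal)
... | ts , r , refl , le′ , bal′ with excursionsOf n r le′ bal′
... | es , refl = pos ts ∷ es , cong (true ∷_) (List.++-assoc (flatF ts) (false ∷ []) (flatEs es))
excursionsOf (suc n) (false ∷ w) (s≤s le) bal
  with firstReturn n (map not w) (subst (_≤ n) (sym (List.length-map not w)) le)
         (trans (ℕ.+-comm (falses w) 1) (trans (sym bal) (sym (falses-map-not w))))
... | ts , r , eq , le′ , bal′
  with excursionsOf n (map not r) (subst (_≤ n) (sym (List.length-map not r)) le′)
         (trans (sym bal′) (sym (falses-map-not r)))
... | es , eqs = neg ts ∷ es , cong (false ∷_) (sym (begin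
  w                                              ≡⟨ sym (map-not-involutive w) ⟩
  map not (map not w)                            ≡⟨ cong (map not) eq ⟩
  map not (flatF ts ++ false ∷ r)                ≡⟨ cong (map not) (sym (List.++-assoc (flatF ts) (false ∷ []) r)) ⟩
  map not ((flatF ts ++ false ∷ []) ++ r)        ≡⟨ List.map-++ not (flatF ts ++ false ∷ []) r ⟩
  map not (flatF ts ++ false ∷ []) ++ map not r  ≡⟨ cong (map not (flatF ts ++ false ∷ []) ++_) (sym eqs) ⟩
  map not (flatF ts ++ false ∷ []) ++ flatEs es  ∎))
  where open ≡-Reasoning

height-suc : ∀ c m → (c ℤ.+ + m) ℤ.+ + 1 ≡ c ℤ.+ + suc m
height-suc c m = trans (ℤ.+-assoc c (+ m) (+ 1)) (cong (λ k → c ℤ.+ + k) (ℕ.+-comm m 1))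

-- Started at height c + m, a Dyck forest has its up-steps starting at heights ≥ c and its
-- down-steps starting at heights > c.
module MarksAbove (P : ℤ → Bool → Bool) (Q : Bool → Bool) (c : ℤ)
  (P-up : ∀ m → P (c ℤ.+ + m) true ≡ Q true) (P-down : ∀ m → P (c ℤ.+ + suc m) false ≡ Q false) where

  mutual
    marks-flatT : ∀ m t → marks P (c ℤ.+ + m) (flatT t) ≡ map Q (flatT t)
    marks-flatT m (node ts) rewrite marks-node P (c ℤ.+ + m) ts | height-suc c m | marks-flatF (suc m) ts
      | P-up m | P-down m | List.map-++ Q (flatF ts) (false ∷ []) = refl

    marks-flatF : ∀ m ts → marks P (c ℤ.+ + m) (flatF ts) ≡ map Q (flatF ts)
    marks-flatF m []       = refl
    marks-flatF m (t ∷ ts) = trans (marks-flatF-∷ P (c ℤ.+ + m) t ts)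
      (trans (cong₂ _++_ (marks-flatT m t) (marks-flatF m ts)) (sym (List.map-++ Q (flatT t) (flatF ts))))

marks-flatF-above : ∀ P Q c → (∀ m → P (c ℤ.+ + m) true ≡ Q true) → (∀ m → P (c ℤ.+ + suc m) false ≡ Q false) →
  ∀ ts → marks P c (flatF ts) ≡ map Q (flatF ts)
marks-flatF-above P Q c up down ts = subst (λ s → marks P s (flatF ts) ≡ map Q (flatF ts)) (ℤ.+-identityʳ c)
  (MarksAbove.marks-flatF P Q c up down 0 ts)

rootMarks : List Tree → List Bool
rootMarks []              = []
rootMarks (node ts ∷ ts′) = (true ∷ blank (flatF ts) ++ false ∷ []) ++ rootMarks ts′

rootMarks-++ : ∀ ts ts′ → rootMarks (ts ++ ts′) ≡ rootMarks ts ++ rootMarks ts′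
rootMarks-++ []             ts′ = refl
rootMarks-++ (node c ∷ ts) ts′ =
  trans (cong ((true ∷ blank (flatF c) ++ false ∷ []) ++_) (rootMarks-++ ts ts′))
    (sym (List.++-assoc (true ∷ blank (flatF c) ++ false ∷ []) (rootMarks ts) (rootMarks ts′)))

trues-rootMarks : ∀ ts → trues (rootMarks ts) ≡ length ts
trues-rootMarks []             = refl
trues-rootMarks (node c ∷ ts) =
  trans (trues-++ (true ∷ blank (flatF c) ++ false ∷ []) (rootMarks ts))
    (cong₂ _+_ (trues-wrap-blank true (flatF c) false) (trues-rootMarks ts))

length-rootMarks : ∀ ts → length (rootMarks ts) ≡ length (flatF ts)
length-rootMarks []             = refl
length-rootMarks (node c ∷ ts) = trans (List.length-++ (true ∷ blank (flatF c) ++ false ∷ []) {rootMarks ts})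
  (trans (cong₂ _+_ (length-wrap true (blank (flatF c)) false true (flatF c) false (List.length-map _ (flatF c))) (length-rootMarks ts))
    (sym (List.length-++ (flatT (node c)) {flatF ts})))

mutual
  trues≡falses-flatT : ∀ t → trues (flatT t) ≡ falses (flatT t)
  trues≡falses-flatT (node ts) = begin
    suc (trues (flatF ts ++ false ∷ []))      ≡⟨ cong suc (trues-++ (flatF ts) (false ∷ [])) ⟩
    suc (trues (flatF ts) + 0)                ≡⟨ cong suc (ℕ.+-identityʳ _) ⟩
    suc (trues (flatF ts))                    ≡⟨ cong suc (trues≡falses-flatF ts) ⟩
    suc (falses (flatF ts))                   ≡⟨ ℕ.+-comm 1 _ ⟩
    falses (flatF ts) + falses (false ∷ [])   ≡⟨ sym (falses-++ (flatF ts) (false ∷ [])) ⟩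
    falses (flatF ts ++ false ∷ [])           ∎
    where open ≡-Reasoning

  trues≡falses-flatF : ∀ ts → trues (flatF ts) ≡ falses (flatF ts)
  trues≡falses-flatF []       = refl
  trues≡falses-flatF (t ∷ ts) = trans (trues-++ (flatT t) (flatF ts))
    (trans (cong₂ _+_ (trues≡falses-flatT t) (trues≡falses-flatF ts)) (sym (falses-++ (flatT t) (flatF ts))))

module RootMarks (P : ℤ → Bool → Bool) (P-root : P (+ 1) true ≡ true) (P-return : P (+ 2) false ≡ false)
  (P-subtree : ∀ ts → marks P (+ 2) (flatF ts) ≡ blank (flatF ts)) where

  marks-flatF₁ : ∀ ts → marks P (+ 1) (flatF ts) ≡ rootMarks ts
  marks-flatF₁ []             = refl
  marks-flatF₁ (node c ∷ ts) = begin
    marks P (+ 1) (flatF (node c ∷ ts))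
      ≡⟨ marks-flatF-∷ P (+ 1) (node c) ts ⟩
    marks P (+ 1) (flatT (node c)) ++ marks P (+ 1) (flatF ts)
      ≡⟨ cong₂ _++_ (marks-node P (+ 1) c) (marks-flatF₁ ts) ⟩
    (P (+ 1) true ∷ marks P (+ 2) (flatF c) ++ P (+ 2) false ∷ []) ++ rootMarks ts
      ≡⟨ cong₃ (λ a m b → (a ∷ m ++ b ∷ []) ++ rootMarks ts) P-root (P-subtree c) P-return ⟩
    rootMarks (node c ∷ ts) ∎
    where open ≡-Reasoning

marks-pos : ∀ P ts {m} → marks P (+ 1) (flatF ts) ≡ m →
  marks P (+ 0) (flatE (pos ts)) ≡ P (+ 0) true ∷ m ++ P (+ 1) false ∷ []
marks-pos P ts eq = trans (marks-node P (+ 0) ts) (cong (λ m → P (+ 0) true ∷ m ++ P (+ 1) false ∷ []) eq)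

marks-neg : ∀ P ts {m} → marks (mirror P) (+ 1) (flatF ts) ≡ m →
  marks P (+ 0) (flatE (neg ts)) ≡ P (+ 0) false ∷ m ++ P -[1+ 0 ] true ∷ []
marks-neg P ts eq = trans (marks-map-not P (+ 0) (flatT (node ts))) (marks-pos (mirror P) ts eq)

upBelow-pos : ∀ ts → marks (upBelowᵖ (+ 0)) (+ 0) (flatE (pos ts)) ≡ false ∷ blank (flatF ts) ++ false ∷ []
upBelow-pos ts = marks-pos _ ts (marks-flatF-above _ _ (+ 1) (λ _ → refl) (λ _ → refl) ts)

upBelow-neg : ∀ ts → marks (upBelowᵖ (+ 0)) (+ 0) (flatE (neg ts)) ≡ false ∷ map not (flatF ts) ++ true ∷ []
upBelow-neg ts = marks-neg _ ts (marks-flatF-above _ not (+ 1) (λ _ → refl) (λ _ → refl) ts)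

downBelow₋₁-pos : ∀ ts → marks (downBelowᵖ -[1+ 0 ]) (+ 0) (flatE (pos ts)) ≡ false ∷ blank (flatF ts) ++ false ∷ []
downBelow₋₁-pos ts = marks-pos _ ts (marks-flatF-above _ _ (+ 1) (λ _ → refl) (λ _ → refl) ts)

downBelow₋₁-neg : ∀ ts → marks (downBelowᵖ -[1+ 0 ]) (+ 0) (flatE (neg ts)) ≡ false ∷ flatF ts ++ false ∷ []
downBelow₋₁-neg ts = marks-neg _ ts (trans (marks-flatF-above _ (λ b → b) (+ 1) (λ _ → refl) (λ _ → refl) ts) (List.map-id (flatF ts)))

downBelow₀-pos : ∀ ts → marks (downBelowᵖ (+ 0)) (+ 0) (flatE (pos ts)) ≡ false ∷ blank (flatF ts) ++ false ∷ []
downBelow₀-pos ts = marks-pos _ ts (marks-flatF-above _ _ (+ 1) (λ _ → refl) (λ _ → refl) ts)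

downBelow₀-neg : ∀ ts → marks (downBelowᵖ (+ 0)) (+ 0) (flatE (neg ts)) ≡ true ∷ flatF ts ++ false ∷ []
downBelow₀-neg ts = marks-neg _ ts (trans (marks-flatF-above _ (λ b → b) (+ 1) (λ _ → refl) (λ _ → refl) ts) (List.map-id (flatF ts)))

downTouch-pos : ∀ ts → marks (downTouchᵖ (+ 0)) (+ 0) (flatE (pos ts)) ≡ false ∷ blank (flatF ts) ++ true ∷ []
downTouch-pos ts = marks-pos _ ts (marks-flatF-above _ _ (+ 1) (λ _ → refl) (λ _ → refl) ts)

downTouch-neg : ∀ ts → marks (downTouchᵖ (+ 0)) (+ 0) (flatE (neg ts)) ≡ true ∷ blank (flatF ts) ++ false ∷ []
downTouch-neg ts = marks-neg _ ts (marks-flatF-above _ _ (+ 1) (λ _ → refl) (λ _ → refl) ts)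

downStart-pos : ∀ ts → marks (downStartᵖ (+ 0)) (+ 0) (flatE (pos ts)) ≡ false ∷ blank (flatF ts) ++ false ∷ []
downStart-pos ts = marks-pos _ ts (marks-flatF-above _ _ (+ 1) (λ _ → refl) (λ _ → refl) ts)

downStart-neg : ∀ ts → marks (downStartᵖ (+ 0)) (+ 0) (flatE (neg ts)) ≡ true ∷ blank (flatF ts) ++ false ∷ []
downStart-neg ts = marks-neg _ ts (marks-flatF-above _ _ (+ 1) (λ _ → refl) (λ _ → refl) ts)

upStart₁-roots : ∀ ts → marks (upStartᵖ (+ 1)) (+ 1) (flatF ts) ≡ rootMarks ts
upStart₁-roots = RootMarks.marks-flatF₁ _ refl refl (marks-flatF-above _ _ (+ 2) (λ _ → refl) (λ _ → refl))

upTouch₁-roots : ∀ ts → marks (upTouchᵖ (+ 1)) (+ 1) (flatF ts) ≡ rootMarks ts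
upTouch₁-roots = RootMarks.marks-flatF₁ _ refl refl (marks-flatF-above _ _ (+ 2) (λ _ → refl) (λ _ → refl))

upStart₁-pos : ∀ ts → marks (upStartᵖ (+ 1)) (+ 0) (flatE (pos ts)) ≡ false ∷ rootMarks ts ++ false ∷ []
upStart₁-pos ts = marks-pos _ ts (upStart₁-roots ts)

upStart₁-neg : ∀ ts → marks (upStartᵖ (+ 1)) (+ 0) (flatE (neg ts)) ≡ false ∷ blank (flatF ts) ++ false ∷ []
upStart₁-neg ts = marks-neg _ ts (marks-flatF-above _ _ (+ 1) (λ _ → refl) (λ _ → refl) ts)

upTouch₁-pos : ∀ ts → marks (upTouchᵖ (+ 1)) (+ 0) (flatE (pos ts)) ≡ true ∷ rootMarks ts ++ false ∷ []
upTouch₁-pos ts = marks-pos _ ts (upTouch₁-roots ts)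

upTouch₁-neg : ∀ ts → marks (upTouchᵖ (+ 1)) (+ 0) (flatE (neg ts)) ≡ false ∷ blank (flatF ts) ++ false ∷ []
upTouch₁-neg ts = marks-neg _ ts (marks-flatF-above _ _ (+ 1) (λ _ → refl) (λ _ → refl) ts)

upStart₁-pos₂ : ∀ ts → marks (upStartᵖ (+ 1)) (+ 2) (flatE (pos ts)) ≡ false ∷ blank (flatF ts) ++ false ∷ []
upStart₁-pos₂ ts = trans (marks-node _ (+ 2) ts)
  (cong (λ m → false ∷ m ++ false ∷ []) (marks-flatF-above _ _ (+ 3) (λ _ → refl) (λ _ → refl) ts))

upStart₁-neg₂ : ∀ ts → marks (upStartᵖ (+ 1)) (+ 2) (flatE (neg ts)) ≡ false ∷ blank (flatF ts) ++ true ∷ []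
upStart₁-neg₂ ts = trans (marks-map-not _ -[1+ 1 ] (flatT (node ts))) (trans (marks-node _ -[1+ 1 ] ts)
  (cong (λ m → false ∷ m ++ true ∷ []) (marks-flatF-above _ _ -[1+ 0 ] (λ _ → refl) (λ { zero → refl ; (suc m) → refl }) ts)))

sumOver : (Excursion → ℕ) → List Excursion → ℕ
sumOver k []       = 0
sumOver k (e ∷ es) = k e + sumOver k es

sumOver-++ : ∀ k es es′ → sumOver k (es ++ es′) ≡ sumOver k es + sumOver k es′
sumOver-++ k []       es′ = refl
sumOver-++ k (e ∷ es) es′ = trans (cong (λ s → k e + s) (sumOver-++ k es es′)) (sym (ℕ.+-assoc (k e) (sumOver k es) (sumOver k es′)))

sumOver-+ : ∀ k k′ es → sumOver (λ e → k e + k′ e) es ≡ sumOver k es + sumOver k′ es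
sumOver-+ k k′ []       = refl
sumOver-+ k k′ (e ∷ es) rewrite sumOver-+ k k′ es = +-interchange (k e) (k′ e) (sumOver k es) (sumOver k′ es)
  where
  +-interchange : ∀ a b c d → (a + b) + (c + d) ≡ (a + c) + (b + d)
  +-interchange = solve-∀

trues-marks-flatEs : ∀ P a (k : Excursion → ℕ) → (∀ e → trues (marks P a (flatE e)) ≡ k e) →
  ∀ es → trues (marks P a (flatEs es)) ≡ sumOver k es
trues-marks-flatEs P a k local []       = refl
trues-marks-flatEs P a k local (e ∷ es) = trans (cong trues (marks-flatEs-∷ P a e es))
  (trans (trues-++ (marks P a (flatE e)) (marks P a (flatEs es))) (cong₂ _+_ (local e) (trues-marks-flatEs P a k local es)))

isPos isNeg roots : Excursion → ℕ
isPos (pos _)  = 1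
isPos (neg _)  = 0
isNeg (pos _)  = 0
isNeg (neg _)  = 1
roots (pos ts) = length ts
roots (neg _)  = 0

positives negatives : List Excursion → ℕ
positives = sumOver isPos
negatives = sumOver isNeg

length≡positives+negatives : ∀ es → length es ≡ positives es + negatives es
length≡positives+negatives []            = refl
length≡positives+negatives (pos _ ∷ es) = cong suc (length≡positives+negatives es)
length≡positives+negatives (neg _ ∷ es) =
  trans (cong suc (length≡positives+negatives es)) (sym (ℕ.+-suc (positives es) (negatives es)))

negatives-asPos : ∀ ts → negatives (map asPos ts) ≡ 0
negatives-asPos []             = refl
negatives-asPos (node c ∷ ts) = negatives-asPos ts

positives-neg : ∀ wss → positives (map neg wss) ≡ 0
positives-neg []         = refl
positives-neg (_ ∷ wss) = positives-neg wss

roots-neg : ∀ wss → sumOver roots (map neg wss) ≡ 0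
roots-neg []         = refl
roots-neg (_ ∷ wss) = roots-neg wss

innerDowns belowCount : Excursion → ℕ
innerDowns (pos _)  = 0
innerDowns (neg ts) = trues (flatF ts)
belowCount e = innerDowns e + isNeg e

d₀-flatEs : ∀ es → d₀ˡ (flatEs es) ≡ negatives es
d₀-flatEs = trues-marks-flatEs _ (+ 0) isNeg λ where
  (pos ts) → trans (cong trues (downStart-pos ts)) (trues-wrap-blank false (flatF ts) false)
  (neg ts) → trans (cong trues (downStart-neg ts)) (trues-wrap-blank true (flatF ts) false)

downTouches-flatE : ∀ e → trues (marks (downTouchᵖ (+ 0)) (+ 0) (flatE e)) ≡ 1
downTouches-flatE (pos ts) = trans (cong trues (downTouch-pos ts)) (trues-wrap-blank false (flatF ts) true)
downTouches-flatE (neg ts) = trans (cong trues (downTouch-neg ts)) (trues-wrap-blank true (flatF ts) false)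

downTouches-flatEs : ∀ es → trues (marks (downTouchᵖ (+ 0)) (+ 0) (flatEs es)) ≡ length es
downTouches-flatEs es = trans (trues-marks-flatEs _ (+ 0) (λ _ → 1) downTouches-flatE es) (sumOver-const es)
  where
  sumOver-const : ∀ es → sumOver (λ _ → 1) es ≡ length es
  sumOver-const []       = refl
  sumOver-const (_ ∷ es) = cong suc (sumOver-const es)

upStarts₁-flatEs : ∀ es → trues (marks (upStartᵖ (+ 1)) (+ 0) (flatEs es)) ≡ sumOver roots es
upStarts₁-flatEs = trues-marks-flatEs _ (+ 0) roots λ where
  (pos ts) → trans (cong trues (upStart₁-pos ts)) (trans (trues-wrap false (rootMarks ts) false)
               (trans (ℕ.+-identityʳ _) (trues-rootMarks ts)))
  (neg ts) → trans (cong trues (upStart₁-neg ts)) (trues-wrap-blank false (flatF ts) false)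

upTouches₁ : List Excursion → List Bool
upTouches₁ es = marks (upTouchᵖ (+ 1)) (+ 0) (flatEs es)

trues-upTouches₁ : ∀ es → trues (upTouches₁ es) ≡ positives es + sumOver roots es
trues-upTouches₁ es = trans (trues-marks-flatEs _ (+ 0) (λ e → isPos e + roots e) local es) (sumOver-+ isPos roots es)
  where
  local : ∀ e → trues (marks (upTouchᵖ (+ 1)) (+ 0) (flatE e)) ≡ isPos e + roots e
  local (pos ts) = trans (cong trues (upTouch₁-pos ts)) (trans (trues-wrap true (rootMarks ts) false)
    (trans (cong (_+ 1) (trues-rootMarks ts)) (ℕ.+-comm (length ts) 1)))
  local (neg ts) = trans (cong trues (upTouch₁-neg ts)) (trues-wrap-blank false (flatF ts) false)

upStarts₁-flatEs₂ : ∀ es → trues (marks (upStartᵖ (+ 1)) (+ 2) (flatEs es)) ≡ negatives es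
upStarts₁-flatEs₂ = trues-marks-flatEs _ (+ 2) isNeg λ where
  (pos ts) → trans (cong trues (upStart₁-pos₂ ts)) (trues-wrap-blank false (flatF ts) false)
  (neg ts) → trans (cong trues (upStart₁-neg₂ ts)) (trues-wrap-blank false (flatF ts) true)

downsBelow₀-flatEs : ∀ es → trues (marks (downBelowᵖ (+ 0)) (+ 0) (flatEs es)) ≡ sumOver belowCount es
downsBelow₀-flatEs = trues-marks-flatEs _ (+ 0) belowCount λ where
  (pos ts) → trans (cong trues (downBelow₀-pos ts)) (trues-wrap-blank false (flatF ts) false)
  (neg ts) → trans (cong trues (downBelow₀-neg ts)) (trues-wrap true (flatF ts) false)

trues-Uˡ : ∀ es → trues (Uˡ (flatEs es)) ≡ sumOver belowCount es
trues-Uˡ = trues-marks-flatEs _ (+ 0) belowCount λ where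
  (pos ts) → trans (cong trues (upBelow-pos ts)) (trues-wrap-blank false (flatF ts) false)
  (neg ts) → trans (cong trues (upBelow-neg ts)) (trans (trues-wrap false (map not (flatF ts)) true)
               (cong (_+ 1) (sym (trues≡falses-flatF ts))))

negatives-none : ∀ es → sumOver belowCount es ≡ 0 → negatives es ≡ 0
negatives-none []            _ = refl
negatives-none (pos _ ∷ es) eq = negatives-none es eq
negatives-none (neg ts ∷ es) eq with () ← ℕ.m+n≡0⇒n≡0 (trues (flatF ts)) (ℕ.m+n≡0⇒m≡0 (trues (flatF ts) + 1) eq)

-- g on an excursion: its unique down-step touching 0 is raised.
raise : Excursion → List Bool
raise (pos ts) = true ∷ flatF ts ++ true ∷ []
raise (neg ts) = true ∷ map not (flatF ts ++ false ∷ [])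

raise-setMarked : ∀ e → setMarked (marks (downTouchᵖ (+ 0)) (+ 0) (flatE e)) 0 true (flatE e) ≡ just (raise e)
raise-setMarked (pos ts) = trans (cong (λ m → setMarked m 0 true (flatE (pos ts))) (downTouch-pos ts))
  (cong (Maybe.map (true ∷_)) (setMarked-blank (flatF ts) {true ∷ []} {x = false ∷ []} refl))
raise-setMarked (neg ts) = cong (λ m → setMarked m 0 true (flatE (neg ts))) (downTouch-neg ts)

g-flatEs : ∀ pre e rest → length pre ≡ negatives (pre ++ e ∷ rest) →
  gˡ (flatEs (pre ++ e ∷ rest)) ≡ just (flatEs pre ++ raise e ++ flatEs rest)
g-flatEs pre e rest len = begin
  gˡ (flatEs (pre ++ e ∷ rest))
    ≡⟨⟩
  setMarked (marks (downTouchᵖ (+ 0)) (+ 0) (flatEs (pre ++ e ∷ rest))) (d₀ˡ (flatEs (pre ++ e ∷ rest))) true (flatEs (pre ++ e ∷ rest))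
    ≡⟨ cong₃ (λ m j x → setMarked m j true x) marks-split index (flatEs-++ pre (e ∷ rest)) ⟩
  setMarked (mPre ++ (marks (downTouchᵖ (+ 0)) (+ 0) (flatE e) ++ _)) (trues mPre + 0) true (flatEs pre ++ (flatE e ++ flatEs rest))
    ≡⟨ setMarked-skip mPre (flatEs pre) (length-marks _ (+ 0) (flatEs pre))
         (setMarked-here (marks _ (+ 0) (flatE e)) (flatE e) (raise-setMarked e)) ⟩
  just (flatEs pre ++ raise e ++ flatEs rest) ∎
  where
  open ≡-Reasoning
  mPre : List Bool
  mPre = marks (downTouchᵖ (+ 0)) (+ 0) (flatEs pre)
  marks-split : marks (downTouchᵖ (+ 0)) (+ 0) (flatEs (pre ++ e ∷ rest)) ≡ mPre ++ (marks _ (+ 0) (flatE e) ++ marks _ (+ 0) (flatEs rest))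
  marks-split = trans (marks-flatEs-++ _ (+ 0) pre (e ∷ rest)) (cong (mPre ++_) (marks-flatEs-∷ _ (+ 0) e rest))
  index : d₀ˡ (flatEs (pre ++ e ∷ rest)) ≡ trues mPre + 0
  index = trans (d₀-flatEs (pre ++ e ∷ rest)) (trans (sym len) (trans (sym (downTouches-flatEs pre)) (sym (ℕ.+-identityʳ _))))

g-undefined : ∀ es → length es ≤ negatives es → gˡ (flatEs es) ≡ nothing
g-undefined es le = setMarked-beyond (marks (downTouchᵖ (+ 0)) (+ 0) (flatEs es))
  (subst₂ _≤_ (sym (downTouches-flatEs es)) (sym (d₀-flatEs es)) le)

endHeight-raise : ∀ e → endHeight (+ 0) (raise e) ≡ + 2
endHeight-raise (pos ts) = trans (endHeight-++ (+ 1) (flatF ts) (true ∷ [])) (cong (λ s → endHeight s (true ∷ [])) (endHeight-flatF (+ 1) ts))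
endHeight-raise (neg ts) = begin
  endHeight (+ 1) (map not (flatF ts ++ false ∷ []))    ≡⟨ endHeight-map-not -[1+ 0 ] (flatF ts ++ false ∷ []) ⟩
  - endHeight -[1+ 0 ] (flatF ts ++ false ∷ [])         ≡⟨ cong -_ (endHeight-++ -[1+ 0 ] (flatF ts) (false ∷ [])) ⟩
  - endHeight (endHeight -[1+ 0 ] (flatF ts)) (false ∷ []) ≡⟨ cong (λ s → - endHeight s (false ∷ [])) (endHeight-flatF -[1+ 0 ] ts) ⟩
  + 2                                                   ∎
  where open ≡-Reasoning

marks-raised : ∀ P pre e rest → marks P (+ 0) (flatEs pre ++ raise e ++ flatEs rest) ≡
  marks P (+ 0) (flatEs pre) ++ (marks P (+ 0) (raise e) ++ marks P (+ 2) (flatEs rest))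
marks-raised P pre e rest = begin
  marks P (+ 0) (flatEs pre ++ raise e ++ flatEs rest)
    ≡⟨ marks-++ P (+ 0) (flatEs pre) (raise e ++ flatEs rest) ⟩
  marks P (+ 0) (flatEs pre) ++ marks P (endHeight (+ 0) (flatEs pre)) (raise e ++ flatEs rest)
    ≡⟨ cong (λ s → marks P (+ 0) (flatEs pre) ++ marks P s (raise e ++ flatEs rest)) (endHeight-flatEs (+ 0) pre) ⟩
  marks P (+ 0) (flatEs pre) ++ marks P (+ 0) (raise e ++ flatEs rest)
    ≡⟨ cong (marks P (+ 0) (flatEs pre) ++_) (marks-++ P (+ 0) (raise e) (flatEs rest)) ⟩
  marks P (+ 0) (flatEs pre) ++ (marks P (+ 0) (raise e) ++ marks P (endHeight (+ 0) (raise e)) (flatEs rest))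
    ≡⟨ cong (λ s → marks P (+ 0) (flatEs pre) ++ (marks P (+ 0) (raise e) ++ marks P s (flatEs rest))) (endHeight-raise e) ⟩
  marks P (+ 0) (flatEs pre) ++ (marks P (+ 0) (raise e) ++ marks P (+ 2) (flatEs rest)) ∎
  where open ≡-Reasoning

upStarts₁-raise : ∀ e → trues (marks (upStartᵖ (+ 1)) (+ 0) (raise e)) ≡ roots e + 1
upStarts₁-raise (pos ts) = begin
  trues (false ∷ marks (upStartᵖ (+ 1)) (+ 1) (flatF ts ++ true ∷ []))
    ≡⟨ cong trues (marks-++ (upStartᵖ (+ 1)) (+ 1) (flatF ts) (true ∷ [])) ⟩
  trues (marks (upStartᵖ (+ 1)) (+ 1) (flatF ts) ++ marks (upStartᵖ (+ 1)) (endHeight (+ 1) (flatF ts)) (true ∷ []))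
    ≡⟨ cong₂ (λ m s → trues (m ++ marks (upStartᵖ (+ 1)) s (true ∷ []))) (upStart₁-roots ts) (endHeight-flatF (+ 1) ts) ⟩
  trues (rootMarks ts ++ true ∷ [])
    ≡⟨ trans (trues-++ (rootMarks ts) (true ∷ [])) (cong (_+ 1) (trues-rootMarks ts)) ⟩
  length ts + 1 ∎
  where open ≡-Reasoning
upStarts₁-raise (neg ts) = begin
  trues (false ∷ marks (upStartᵖ (+ 1)) (+ 1) (map not (flatF ts ++ false ∷ [])))
    ≡⟨ cong trues (marks-map-not (upStartᵖ (+ 1)) -[1+ 0 ] (flatF ts ++ false ∷ [])) ⟩
  trues (marks Q -[1+ 0 ] (flatF ts ++ false ∷ []))
    ≡⟨ cong trues (marks-++ Q -[1+ 0 ] (flatF ts) (false ∷ [])) ⟩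
  trues (marks Q -[1+ 0 ] (flatF ts) ++ marks Q (endHeight -[1+ 0 ] (flatF ts)) (false ∷ []))
    ≡⟨ cong₂ (λ m s → trues (m ++ marks Q s (false ∷ []))) (marks-flatF-above Q _ -[1+ 0 ] (λ _ → refl) (λ { zero → refl ; (suc m) → refl }) ts)
         (endHeight-flatF -[1+ 0 ] ts) ⟩
  trues (blank (flatF ts) ++ true ∷ [])
    ≡⟨ trans (trues-++ (blank (flatF ts)) (true ∷ [])) (cong (_+ 1) (trues-blank (flatF ts))) ⟩
  1 ∎
  where
  open ≡-Reasoning
  Q : ℤ → Bool → Bool
  Q = mirror (upStartᵖ (+ 1))

u₁-raised : ∀ pre e rest → u₁ˡ (flatEs pre ++ raise e ++ flatEs rest) ≡ sumOver roots pre + (roots e + 1 + negatives rest)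
u₁-raised pre e rest = begin
  trues (marks P (+ 0) (flatEs pre ++ raise e ++ flatEs rest))
    ≡⟨ cong trues (marks-raised P pre e rest) ⟩
  trues (marks P (+ 0) (flatEs pre) ++ (marks P (+ 0) (raise e) ++ marks P (+ 2) (flatEs rest)))
    ≡⟨ trues-++₃ (marks P (+ 0) (flatEs pre)) (marks P (+ 0) (raise e)) _ ⟩
  trues (marks P (+ 0) (flatEs pre)) + (trues (marks P (+ 0) (raise e)) + trues (marks P (+ 2) (flatEs rest)))
    ≡⟨ cong₃ (λ a b c → a + (b + c)) (upStarts₁-flatEs pre) (upStarts₁-raise e) (upStarts₁-flatEs₂ rest) ⟩
  sumOver roots pre + (roots e + 1 + negatives rest) ∎
  where
  open ≡-Reasoning
  P : ℤ → Bool → Bool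
  P = upStartᵖ (+ 1)

-- The excursions left by lowering, in true ∷ flatF ts ++ y ∷ [], the root step of the last tree
-- of ts (the first step if ts = []).
lowerLastRoot : List Tree → List Excursion
lowerLastRoot ts with reverseView ts
... | []              = []
... | ts′ ∶ _ ∶ʳ node c = pos ts′ ∷ map asPos c

negatives-lowerLastRoot : ∀ ts → negatives (lowerLastRoot ts) ≡ 0
negatives-lowerLastRoot ts with reverseView ts
... | []              = refl
... | _ ∶ _ ∶ʳ node z = negatives-asPos z

setMarked-lastRoot : ∀ ts c y → setMarked (true ∷ rootMarks ts ++ c ∷ []) (length ts) false (true ∷ flatF ts ++ y ∷ []) ≡
  just (flatEs (lowerLastRoot ts) ++ false ∷ y ∷ [])
setMarked-lastRoot ts c y with reverseView ts
... | []               = refl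
... | ts′ ∶ _ ∶ʳ node z = begin
  setMarked (true ∷ rootMarks (ts′ ∷ʳ t) ++ c ∷ []) (length (ts′ ∷ʳ t)) false (true ∷ flatF (ts′ ∷ʳ t) ++ y ∷ [])
    ≡⟨ cong₃ (λ m j x → setMarked (true ∷ m) j false (true ∷ x)) marks-split index steps-split ⟩
  Maybe.map (true ∷_)
    (setMarked (rootMarks ts′ ++ (rootMarks (t ∷ []) ++ c ∷ [])) (trues (rootMarks ts′) + 0) false (flatF ts′ ++ (flatT t ++ y ∷ [])))
    ≡⟨ cong (Maybe.map (true ∷_)) (setMarked-skip (rootMarks ts′) (flatF ts′) (length-rootMarks ts′) refl) ⟩
  just (true ∷ flatF ts′ ++ false ∷ (flatF z ++ false ∷ []) ++ y ∷ [])
    ≡⟨ cong just (++-reassoc (true ∷ []) (false ∷ []) (y ∷ [])) ⟩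
  just (((true ∷ flatF ts′ ++ false ∷ []) ++ flatF z) ++ false ∷ y ∷ [])
    ≡⟨ cong (λ l → just (((true ∷ flatF ts′ ++ false ∷ []) ++ l) ++ false ∷ y ∷ [])) (sym (flatEs-asPos z)) ⟩
  just (flatEs (pos ts′ ∷ map asPos z) ++ false ∷ y ∷ []) ∎
  where
  open ≡-Reasoning
  t : Tree
  t = node z
  marks-split : rootMarks (ts′ ∷ʳ t) ++ c ∷ [] ≡ rootMarks ts′ ++ (rootMarks (t ∷ []) ++ c ∷ [])
  marks-split = trans (cong (_++ c ∷ []) (rootMarks-++ ts′ (t ∷ [])))
    (List.++-assoc (rootMarks ts′) (rootMarks (t ∷ [])) (c ∷ []))
  index : length (ts′ ∷ʳ t) ≡ suc (trues (rootMarks ts′) + 0)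
  index = trans (List.length-++ ts′) (trans (ℕ.+-comm (length ts′) 1)
    (cong suc (trans (sym (trues-rootMarks ts′)) (sym (ℕ.+-identityʳ _)))))
  steps-split : flatF (ts′ ∷ʳ t) ++ y ∷ [] ≡ flatF ts′ ++ (flatT t ++ y ∷ [])
  steps-split = trans (cong (_++ y ∷ []) (flatF-++ ts′ (t ∷ []))) (trans (List.++-assoc (flatF ts′) (flatT t ++ []) (y ∷ []))
    (cong (λ l → flatF ts′ ++ (l ++ y ∷ [])) (List.++-identityʳ (flatT t))))
  ++-reassoc : ∀ (T F Y : List Bool) → T ++ (flatF ts′ ++ (F ++ ((flatF z ++ F) ++ Y))) ≡ ((T ++ (flatF ts′ ++ F)) ++ flatF z) ++ F ++ Y
  ++-reassoc T F Y = solve (List.++-monoid Bool)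

hˡ-suc : ∀ l {j} → u₁ˡ l ≡ suc j → hˡ l ≡ setMarked (marks (upTouchᵖ (+ 1)) (+ 0) l) j false l
hˡ-suc l eq rewrite eq = refl

lower-at : ∀ pre x rest′ {m mRest j z} →
  u₁ˡ (flatEs pre ++ x ++ rest′) ≡ suc (trues (upTouches₁ pre) + j) →
  marks (upTouchᵖ (+ 1)) (+ 0) (flatEs pre ++ x ++ rest′) ≡ upTouches₁ pre ++ m ++ mRest →
  setMarked m j false x ≡ just z →
  hˡ (flatEs pre ++ x ++ rest′) ≡ just (flatEs pre ++ z ++ rest′)
lower-at pre x rest′ {m} {j = j} u₁-eq marks-eq set-eq =
  trans (hˡ-suc (flatEs pre ++ x ++ rest′) u₁-eq)
    (trans (cong (λ m′ → setMarked m′ (trues (upTouches₁ pre) + j) false (flatEs pre ++ x ++ rest′)) marks-eq)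
    (setMarked-skip (upTouches₁ pre) (flatEs pre) (length-marks _ (+ 0) (flatEs pre)) (setMarked-here m x set-eq)))

upTouch₁-raise-pos : ∀ ts → marks (upTouchᵖ (+ 1)) (+ 0) (raise (pos ts)) ≡ true ∷ rootMarks ts ++ true ∷ []
upTouch₁-raise-pos ts = cong (true ∷_) (trans (marks-++ _ (+ 1) (flatF ts) (true ∷ []))
  (cong₂ (λ m s → m ++ upTouchᵖ (+ 1) s true ∷ []) (upTouch₁-roots ts) (endHeight-flatF (+ 1) ts)))

-- The invariant Φ = origin (d₀ x) (excursions of x)

flipped : Bool → Excursion → List Bool
flipped true  (pos ts) = raise (pos ts)
flipped true  (neg ts) = flatE (pos ts)
flipped false (pos ts) = flatE (pos ts)
flipped false (neg ts) = false ∷ flatF ts ++ false ∷ []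

origin : ℕ → List Excursion → List Bool
origin k       []       = []
origin zero    (e ∷ es) = flipped false e ++ origin zero es
origin (suc k) (e ∷ es) = flipped true e ++ origin k es

origin-++ : ∀ k es es′ → origin (length es + k) (es ++ es′) ≡ origin (length es) es ++ origin k es′
origin-++ k []       es′ = refl
origin-++ k (e ∷ es) es′ =
  trans (cong (flipped true e ++_) (origin-++ k es es′)) (sym (List.++-assoc (flipped true e) (origin (length es) es) (origin k es′)))

origin₀-++ : ∀ es es′ → origin 0 (es ++ es′) ≡ origin 0 es ++ origin 0 es′
origin₀-++ []       es′ = refl
origin₀-++ (e ∷ es) es′ =
  trans (cong (flipped false e ++_) (origin₀-++ es es′)) (sym (List.++-assoc (flipped false e) (origin 0 es) (origin 0 es′)))

origin₀-nonneg : ∀ es → negatives es ≡ 0 → origin 0 es ≡ flatEs es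
origin₀-nonneg []            _  = refl
origin₀-nonneg (pos ts ∷ es) eq = cong (flatE (pos ts) ++_) (origin₀-nonneg es eq)

origin₀-asPos : ∀ ts → origin 0 (map asPos ts) ≡ flatF ts
origin₀-asPos []             = refl
origin₀-asPos (node c ∷ ts) = cong (flatT (node c) ++_) (origin₀-asPos ts)

origin-neg : ∀ wss → origin (length wss) (map neg wss) ≡ flatF (map node wss)
origin-neg []         = refl
origin-neg (ws ∷ wss) = cong (flatT (node ws) ++_) (origin-neg wss)

origin-lowerLastRoot : ∀ ts us rest →
  origin 1 (lowerLastRoot ts ++ neg us ∷ rest) ≡ (true ∷ flatF ts ++ flatF us ++ false ∷ []) ++ origin 0 rest
origin-lowerLastRoot ts us rest with reverseView ts
... | []               = refl
... | ts′ ∶ _ ∶ʳ node z = begin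
  raise (pos ts′) ++ origin 0 (map asPos z ++ neg us ∷ rest)
    ≡⟨ cong (raise (pos ts′) ++_) (trans (origin₀-++ (map asPos z) (neg us ∷ rest)) (cong (_++ _) (origin₀-asPos z))) ⟩
  (true ∷ flatF ts′ ++ true ∷ []) ++ flatF z ++ (false ∷ flatF us ++ false ∷ []) ++ origin 0 rest
    ≡⟨ ++-reassoc (true ∷ []) (false ∷ []) ⟩
  (true ∷ (flatF ts′ ++ (true ∷ flatF z ++ false ∷ []) ++ []) ++ flatF us ++ false ∷ []) ++ origin 0 rest
    ≡⟨ cong (λ l → true ∷ (l ++ flatF us ++ false ∷ []) ++ origin 0 rest) (sym (flatF-++ ts′ (node z ∷ []))) ⟩
  (true ∷ flatF (ts′ ∷ʳ node z) ++ flatF us ++ false ∷ []) ++ origin 0 rest ∎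
  where
  open ≡-Reasoning
  ++-reassoc : ∀ (T F : List Bool) → (T ++ (flatF ts′ ++ T)) ++ (flatF z ++ ((F ++ (flatF us ++ F)) ++ origin 0 rest))
    ≡ T ++ ((flatF ts′ ++ ((T ++ (flatF z ++ F)) ++ [])) ++ flatF us ++ F) ++ origin 0 rest
  ++-reassoc T F = solve (List.++-monoid Bool)

positives-before : ∀ pre e rest → length pre ≡ negatives (pre ++ e ∷ rest) → positives pre ≡ isNeg e + negatives rest
positives-before pre e rest len = ℕ.+-cancelʳ-≡ (negatives pre) _ _ (begin
  positives pre + negatives pre          ≡⟨ sym (length≡positives+negatives pre) ⟩
  length pre                             ≡⟨ len ⟩
  negatives (pre ++ e ∷ rest)            ≡⟨ sumOver-++ isNeg pre (e ∷ rest) ⟩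
  negatives pre + (isNeg e + negatives rest) ≡⟨ ℕ.+-comm (negatives pre) _ ⟩
  (isNeg e + negatives rest) + negatives pre ∎)
  where open ≡-Reasoning

negatives-lowered : ∀ pre ts us rest → negatives (pre ++ lowerLastRoot ts ++ neg us ∷ rest) ≡ negatives pre + suc (negatives rest)
negatives-lowered pre ts us rest = trans (sumOver-++ isNeg pre _)
  (cong (λ n → negatives pre + n) (trans (sumOver-++ isNeg (lowerLastRoot ts) _) (cong (_+ suc (negatives rest)) (negatives-lowerLastRoot ts))))

Step : List Excursion → Set
Step es = ∃ λ es′ → fˡ (flatEs es) ≡ just (flatEs es′) × origin (negatives es′) es′ ≡ origin (negatives es) es

-- The (d₀+1)-th excursion is positive: g raises its last step, h lowers the root step of its last tree.
module StepPos (pre : List Excursion) (ts : List Tree) (rest : List Excursion)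
  (len : length pre ≡ negatives (pre ++ pos ts ∷ rest)) where

  open ≡-Reasoning

  N R : ℕ
  N = negatives rest
  R = sumOver roots pre

  balance : positives pre ≡ N
  balance = positives-before pre (pos ts) rest len

  u₁-eq : u₁ˡ (flatEs pre ++ raise (pos ts) ++ flatEs rest) ≡ suc (trues (upTouches₁ pre) + length ts)
  u₁-eq = begin
    u₁ˡ (flatEs pre ++ raise (pos ts) ++ flatEs rest) ≡⟨ u₁-raised pre (pos ts) rest ⟩
    R + (length ts + 1 + N)                           ≡⟨ rearrange R (length ts) N ⟩
    suc ((N + R) + length ts)                         ≡⟨ cong (λ p → suc ((p + R) + length ts)) (sym balance) ⟩
    suc ((positives pre + R) + length ts)             ≡⟨ cong (λ n → suc (n + length ts)) (sym (trues-upTouches₁ pre)) ⟩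
    suc (trues (upTouches₁ pre) + length ts)          ∎
    where
    rearrange : ∀ r t n → r + (t + 1 + n) ≡ suc ((n + r) + t)
    rearrange = solve-∀

  marks-eq : marks (upTouchᵖ (+ 1)) (+ 0) (flatEs pre ++ raise (pos ts) ++ flatEs rest) ≡
    upTouches₁ pre ++ (true ∷ rootMarks ts ++ true ∷ []) ++ marks (upTouchᵖ (+ 1)) (+ 2) (flatEs rest)
  marks-eq = trans (marks-raised _ pre (pos ts) rest)
    (cong (λ m → upTouches₁ pre ++ m ++ marks (upTouchᵖ (+ 1)) (+ 2) (flatEs rest)) (upTouch₁-raise-pos ts))

  f-eq : fˡ (flatEs (pre ++ pos ts ∷ rest)) ≡ just (flatEs (pre ++ lowerLastRoot ts ++ neg [] ∷ rest))
  f-eq = begin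
    fˡ (flatEs (pre ++ pos ts ∷ rest))
      ≡⟨ cong (_>>= hˡ) (g-flatEs pre (pos ts) rest len) ⟩
    hˡ (flatEs pre ++ raise (pos ts) ++ flatEs rest)
      ≡⟨ lower-at pre (raise (pos ts)) (flatEs rest) {m = true ∷ rootMarks ts ++ true ∷ []} u₁-eq marks-eq
           (setMarked-lastRoot ts true true) ⟩
    just (flatEs pre ++ (flatEs (lowerLastRoot ts) ++ flatE (neg [])) ++ flatEs rest)
      ≡⟨ cong (λ l → just (flatEs pre ++ l)) (List.++-assoc (flatEs (lowerLastRoot ts)) _ (flatEs rest)) ⟩
    just (flatEs pre ++ flatEs (lowerLastRoot ts) ++ flatEs (neg [] ∷ rest))
      ≡⟨ cong (λ l → just (flatEs pre ++ l)) (sym (flatEs-++ (lowerLastRoot ts) (neg [] ∷ rest))) ⟩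
    just (flatEs pre ++ flatEs (lowerLastRoot ts ++ neg [] ∷ rest))
      ≡⟨ cong just (sym (flatEs-++ pre _)) ⟩
    just (flatEs (pre ++ lowerLastRoot ts ++ neg [] ∷ rest)) ∎

  negatives-before : negatives (pre ++ pos ts ∷ rest) ≡ length pre + 0
  negatives-before = trans (sym len) (sym (ℕ.+-identityʳ _))

  negatives-after : negatives (pre ++ lowerLastRoot ts ++ neg [] ∷ rest) ≡ length pre + 1
  negatives-after = begin
    negatives (pre ++ lowerLastRoot ts ++ neg [] ∷ rest) ≡⟨ negatives-lowered pre ts [] rest ⟩
    negatives pre + suc N                               ≡⟨ trans (ℕ.+-suc (negatives pre) N) (ℕ.+-comm 1 _) ⟩
    negatives pre + N + 1                               ≡⟨ cong (λ n → n + 1) (trans (ℕ.+-comm (negatives pre) N) (cong (_+ negatives pre) (sym balance))) ⟩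
    positives pre + negatives pre + 1                   ≡⟨ cong (_+ 1) (sym (length≡positives+negatives pre)) ⟩
    length pre + 1                                      ∎

  origin-eq : origin (negatives (pre ++ lowerLastRoot ts ++ neg [] ∷ rest)) (pre ++ lowerLastRoot ts ++ neg [] ∷ rest) ≡
    origin (negatives (pre ++ pos ts ∷ rest)) (pre ++ pos ts ∷ rest)
  origin-eq = begin
    origin (negatives (pre ++ lowerLastRoot ts ++ neg [] ∷ rest)) (pre ++ lowerLastRoot ts ++ neg [] ∷ rest)
      ≡⟨ cong (λ k → origin k (pre ++ lowerLastRoot ts ++ neg [] ∷ rest)) negatives-after ⟩
    origin (length pre + 1) (pre ++ lowerLastRoot ts ++ neg [] ∷ rest)
      ≡⟨ origin-++ 1 pre _ ⟩
    origin (length pre) pre ++ origin 1 (lowerLastRoot ts ++ neg [] ∷ rest)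
      ≡⟨ cong (origin (length pre) pre ++_) (origin-lowerLastRoot ts [] rest) ⟩
    origin (length pre) pre ++ origin 0 (pos ts ∷ rest)
      ≡⟨ sym (origin-++ 0 pre (pos ts ∷ rest)) ⟩
    origin (length pre + 0) (pre ++ pos ts ∷ rest)
      ≡⟨ cong (λ k → origin k (pre ++ pos ts ∷ rest)) (sym negatives-before) ⟩
    origin (negatives (pre ++ pos ts ∷ rest)) (pre ++ pos ts ∷ rest) ∎

  step : Step (pre ++ pos ts ∷ rest)
  step = pre ++ lowerLastRoot ts ++ neg [] ∷ rest , f-eq , origin-eq

data LastPositive : List Excursion → Set where
  allNeg  : ∀ wss → LastPositive (map neg wss)
  lastPos : ∀ pre ts wss → LastPositive (pre ++ pos ts ∷ map neg wss)

lastPositive : ∀ es → LastPositive es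
lastPositive []       = allNeg []
lastPositive (e ∷ es) with lastPositive es
lastPositive (e ∷ es)     | lastPos pre ts wss = lastPos (e ∷ pre) ts wss
lastPositive (pos ts ∷ _) | allNeg wss         = lastPos [] ts wss
lastPositive (neg ws ∷ _) | allNeg wss         = allNeg (ws ∷ wss)

flatEs-neg : ∀ wss → flatEs (map neg wss) ≡ map not (flatF (map node wss))
flatEs-neg []         = refl
flatEs-neg (ws ∷ wss) = trans (cong (flatE (neg ws) ++_) (flatEs-neg wss)) (sym (List.map-++ not (flatT (node ws)) (flatF (map node wss))))

flatE-neg-graft : ∀ ws vs → flatE (neg (node ws ∷ vs)) ≡ false ∷ false ∷ map not (flatF ws) ++ raise (neg vs)
flatE-neg-graft ws vs = cong (false ∷_) (begin
  map not ((flatT (node ws) ++ flatF vs) ++ false ∷ [])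
    ≡⟨ cong (map not) (List.++-assoc (true ∷ flatF ws ++ false ∷ []) (flatF vs) (false ∷ [])) ⟩
  false ∷ map not ((flatF ws ++ false ∷ []) ++ flatF vs ++ false ∷ [])
    ≡⟨ cong (false ∷_) (List.map-++ not (flatF ws ++ false ∷ []) (flatF vs ++ false ∷ [])) ⟩
  false ∷ map not (flatF ws ++ false ∷ []) ++ map not (flatF vs ++ false ∷ [])
    ≡⟨ cong (λ l → false ∷ l ++ map not (flatF vs ++ false ∷ [])) (List.map-++ not (flatF ws) (false ∷ [])) ⟩
  false ∷ (map not (flatF ws) ++ true ∷ []) ++ map not (flatF vs ++ false ∷ [])
    ≡⟨ cong (false ∷_) (List.++-assoc (map not (flatF ws)) (true ∷ []) _) ⟩
  false ∷ map not (flatF ws) ++ raise (neg vs) ∎)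
  where open ≡-Reasoning

-- The (d₀+1)-th excursion is negative: g raises its first step, and h lowers the root step of the
-- last tree of the last positive excursion before it, which exists because the positives before
-- balance the negatives after; the negative excursions in between become subtrees of a new one.
module StepNeg (A : List Excursion) (ts : List Tree) (wss : List (List Tree)) (vs : List Tree) (rest : List Excursion)
  (len : length (A ++ pos ts ∷ map neg wss) ≡ negatives ((A ++ pos ts ∷ map neg wss) ++ neg vs ∷ rest)) where

  open ≡-Reasoning

  grafted : List Tree
  grafted = node (map node wss) ∷ vs

  Ns es′ : List Excursion
  Ns = map neg wss
  es′ = A ++ lowerLastRoot ts ++ neg grafted ∷ rest

  N : ℕ
  N = negatives rest

  XR : List Bool
  XR = flatEs Ns ++ raise (neg vs) ++ flatEs rest

  balance : positives A ≡ N
  balance = ℕ.+-cancelʳ-≡ 1 _ _ (begin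
    positives A + 1                        ≡⟨ cong (λ n → positives A + suc n) (sym (positives-neg wss)) ⟩
    positives A + (1 + positives Ns)       ≡⟨ sym (sumOver-++ isPos A (pos ts ∷ Ns)) ⟩
    positives (A ++ pos ts ∷ Ns)           ≡⟨ positives-before (A ++ pos ts ∷ Ns) (neg vs) rest len ⟩
    1 + N                                  ≡⟨ ℕ.+-comm 1 N ⟩
    N + 1                                  ∎)

  reshape : flatEs (A ++ pos ts ∷ Ns) ++ raise (neg vs) ++ flatEs rest ≡ flatEs A ++ flatE (pos ts) ++ XR
  reshape = trans (cong (_++ raise (neg vs) ++ flatEs rest) (flatEs-++ A (pos ts ∷ Ns))) (++-reassoc (flatEs A) (flatE (pos ts)) (flatEs Ns) _)
    where
    ++-reassoc : ∀ (a b c d : List Bool) → (a ++ (b ++ c)) ++ d ≡ a ++ (b ++ (c ++ d))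
    ++-reassoc a b c d = solve (List.++-monoid Bool)

  u₁-eq : u₁ˡ (flatEs A ++ flatE (pos ts) ++ XR) ≡ suc (trues (upTouches₁ A) + length ts)
  u₁-eq = begin
    u₁ˡ (flatEs A ++ flatE (pos ts) ++ XR)                 ≡⟨ cong u₁ˡ (sym reshape) ⟩
    u₁ˡ (flatEs (A ++ pos ts ∷ Ns) ++ raise (neg vs) ++ flatEs rest) ≡⟨ u₁-raised (A ++ pos ts ∷ Ns) (neg vs) rest ⟩
    sumOver roots (A ++ pos ts ∷ Ns) + (0 + 1 + N)          ≡⟨ cong (_+ suc N) (sumOver-++ roots A (pos ts ∷ Ns)) ⟩
    sumOver roots A + (length ts + sumOver roots Ns) + suc N ≡⟨ cong (λ r → sumOver roots A + (length ts + r) + suc N) (roots-neg wss) ⟩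
    sumOver roots A + (length ts + 0) + suc N               ≡⟨ rearrange (sumOver roots A) (length ts) N ⟩
    suc ((N + sumOver roots A) + length ts)                 ≡⟨ cong (λ p → suc ((p + sumOver roots A) + length ts)) (sym balance) ⟩
    suc ((positives A + sumOver roots A) + length ts)       ≡⟨ cong (λ n → suc (n + length ts)) (sym (trues-upTouches₁ A)) ⟩
    suc (trues (upTouches₁ A) + length ts)                  ∎
    where
    rearrange : ∀ r t n → r + (t + 0) + suc n ≡ suc ((n + r) + t)
    rearrange = solve-∀

  marks-eq : marks (upTouchᵖ (+ 1)) (+ 0) (flatEs A ++ flatE (pos ts) ++ XR) ≡
    upTouches₁ A ++ (true ∷ rootMarks ts ++ false ∷ []) ++ marks (upTouchᵖ (+ 1)) (+ 0) XR
  marks-eq = trans (marks-flatEs-prefix _ A _) (cong (upTouches₁ A ++_)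
    (trans (marks-flatE-prefix _ (pos ts) XR) (cong (_++ marks (upTouchᵖ (+ 1)) (+ 0) XR) (upTouch₁-pos ts))))

  regroup : flatEs A ++ (flatEs (lowerLastRoot ts) ++ false ∷ false ∷ []) ++ XR ≡ flatEs es′
  regroup = begin
    flatEs A ++ (flatEs (lowerLastRoot ts) ++ false ∷ false ∷ []) ++ XR
      ≡⟨ cong (λ l → flatEs A ++ (flatEs (lowerLastRoot ts) ++ false ∷ false ∷ []) ++ l ++ raise (neg vs) ++ flatEs rest) (flatEs-neg wss) ⟩
    flatEs A ++ (flatEs (lowerLastRoot ts) ++ false ∷ false ∷ []) ++ map not (flatF (map node wss)) ++ raise (neg vs) ++ flatEs rest
      ≡⟨ ++-reassoc (flatEs A) (flatEs (lowerLastRoot ts)) (false ∷ []) (map not (flatF (map node wss))) (raise (neg vs)) (flatEs rest) ⟩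
    flatEs A ++ flatEs (lowerLastRoot ts) ++ (false ∷ false ∷ map not (flatF (map node wss)) ++ raise (neg vs)) ++ flatEs rest
      ≡⟨ cong (λ l → flatEs A ++ flatEs (lowerLastRoot ts) ++ l ++ flatEs rest) (sym (flatE-neg-graft (map node wss) vs)) ⟩
    flatEs A ++ flatEs (lowerLastRoot ts) ++ flatEs (neg grafted ∷ rest)
      ≡⟨ cong (flatEs A ++_) (sym (flatEs-++ (lowerLastRoot ts) (neg grafted ∷ rest))) ⟩
    flatEs A ++ flatEs (lowerLastRoot ts ++ neg grafted ∷ rest)
      ≡⟨ sym (flatEs-++ A _) ⟩
    flatEs es′ ∎
    where
    ++-reassoc : ∀ (a k f w r z : List Bool) → a ++ (k ++ (f ++ f)) ++ (w ++ (r ++ z)) ≡ a ++ (k ++ ((f ++ (f ++ (w ++ r))) ++ z))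
    ++-reassoc a k f w r z = solve (List.++-monoid Bool)

  f-eq : fˡ (flatEs ((A ++ pos ts ∷ Ns) ++ neg vs ∷ rest)) ≡ just (flatEs es′)
  f-eq = begin
    fˡ (flatEs ((A ++ pos ts ∷ Ns) ++ neg vs ∷ rest))
      ≡⟨ cong (_>>= hˡ) (g-flatEs (A ++ pos ts ∷ Ns) (neg vs) rest len) ⟩
    hˡ (flatEs (A ++ pos ts ∷ Ns) ++ raise (neg vs) ++ flatEs rest)
      ≡⟨ cong hˡ reshape ⟩
    hˡ (flatEs A ++ flatE (pos ts) ++ XR)
      ≡⟨ lower-at A (flatE (pos ts)) XR {m = true ∷ rootMarks ts ++ false ∷ []} u₁-eq marks-eq (setMarked-lastRoot ts false false) ⟩
    just (flatEs A ++ (flatEs (lowerLastRoot ts) ++ false ∷ false ∷ []) ++ XR)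
      ≡⟨ cong just regroup ⟩
    just (flatEs es′) ∎

  negatives-before : negatives ((A ++ pos ts ∷ Ns) ++ neg vs ∷ rest) ≡ length A + suc (length wss)
  negatives-before = trans (sym len) (trans (List.length-++ A) (cong (λ n → length A + suc n) (List.length-map neg wss)))

  negatives-after : negatives es′ ≡ length A + 1
  negatives-after = begin
    negatives es′                    ≡⟨ negatives-lowered A ts grafted rest ⟩
    negatives A + suc N              ≡⟨ trans (ℕ.+-suc (negatives A) N) (ℕ.+-comm 1 _) ⟩
    negatives A + N + 1              ≡⟨ cong (_+ 1) (trans (ℕ.+-comm (negatives A) N) (cong (_+ negatives A) (sym balance))) ⟩
    positives A + negatives A + 1    ≡⟨ cong (_+ 1) (sym (length≡positives+negatives A)) ⟩
    length A + 1                     ∎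

  origin-eq : origin (negatives es′) es′ ≡
    origin (negatives ((A ++ pos ts ∷ Ns) ++ neg vs ∷ rest)) ((A ++ pos ts ∷ Ns) ++ neg vs ∷ rest)
  origin-eq = begin
    origin (negatives es′) es′
      ≡⟨ cong (λ k → origin k es′) negatives-after ⟩
    origin (length A + 1) es′
      ≡⟨ origin-++ 1 A _ ⟩
    origin (length A) A ++ origin 1 (lowerLastRoot ts ++ neg grafted ∷ rest)
      ≡⟨ cong (origin (length A) A ++_) (origin-lowerLastRoot ts grafted rest) ⟩
    origin (length A) A ++ (true ∷ flatF ts ++ flatF grafted ++ false ∷ []) ++ origin 0 rest
      ≡⟨ cong (origin (length A) A ++_) (++-reassoc (true ∷ []) (false ∷ []) (flatF ts) (flatF (map node wss)) (flatF vs) (origin 0 rest)) ⟩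
    origin (length A) A ++ raise (pos ts) ++ flatF (map node wss) ++ origin 0 (neg vs ∷ rest)
      ≡⟨ cong (λ l → origin (length A) A ++ raise (pos ts) ++ l ++ origin 0 (neg vs ∷ rest))
           (trans (sym (origin-neg wss)) (cong (λ k → origin k Ns) (sym (List.length-map neg wss)))) ⟩
    origin (length A) A ++ raise (pos ts) ++ origin (length Ns) Ns ++ origin 0 (neg vs ∷ rest)
      ≡⟨ cong (λ l → origin (length A) A ++ raise (pos ts) ++ l) (sym (origin-++ 0 Ns (neg vs ∷ rest))) ⟩
    origin (length A) A ++ origin (suc (length Ns + 0)) (pos ts ∷ Ns ++ neg vs ∷ rest)
      ≡⟨ cong (λ k → origin (length A) A ++ origin (suc k) (pos ts ∷ Ns ++ neg vs ∷ rest)) (trans (ℕ.+-identityʳ _) (List.length-map neg wss)) ⟩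
    origin (length A) A ++ origin (suc (length wss)) (pos ts ∷ Ns ++ neg vs ∷ rest)
      ≡⟨ sym (origin-++ (suc (length wss)) A _) ⟩
    origin (length A + suc (length wss)) (A ++ pos ts ∷ Ns ++ neg vs ∷ rest)
      ≡⟨ cong₂ origin (sym negatives-before) (sym (List.++-assoc A (pos ts ∷ Ns) (neg vs ∷ rest))) ⟩
    origin (negatives ((A ++ pos ts ∷ Ns) ++ neg vs ∷ rest)) ((A ++ pos ts ∷ Ns) ++ neg vs ∷ rest) ∎
    where
    ++-reassoc : ∀ (T F s w v o : List Bool) →
      T ++ ((s ++ (((T ++ (w ++ F)) ++ v) ++ F)) ++ o) ≡ (T ++ (s ++ T)) ++ (w ++ ((F ++ (v ++ F)) ++ o))
    ++-reassoc T F s w v o = solve (List.++-monoid Bool)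

  step : Step ((A ++ pos ts ∷ Ns) ++ neg vs ∷ rest)
  step = es′ , f-eq , origin-eq

step-neg : ∀ pre vs rest → length pre ≡ negatives (pre ++ neg vs ∷ rest) → Step (pre ++ neg vs ∷ rest)
step-neg pre vs rest len with lastPositive pre
... | allNeg wss       = ⊥-elim (ℕ.0≢1+n (trans (sym (positives-neg wss)) (positives-before (map neg wss) (neg vs) rest len)))
... | lastPos A ts wss = StepNeg.step A ts wss vs rest len

step-at : ∀ pre e rest → length pre ≡ negatives (pre ++ e ∷ rest) → Step (pre ++ e ∷ rest)
step-at pre (pos ts) rest = StepPos.step pre ts rest
step-at pre (neg vs) rest = step-neg pre vs rest

f-step : ∀ es {l} → fˡ (flatEs es) ≡ just l →
  ∃ λ es′ → l ≡ flatEs es′ × origin (negatives es′) es′ ≡ origin (negatives es) es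
f-step es eq with splitAt (negatives es) es
... | inj₁ le with () ← trans (sym (cong (_>>= hˡ) (g-undefined es le))) eq
... | inj₂ (pre , e , rest , refl , len) with step-at pre e rest len
... | es′ , f-eq , origin-eq = es′ , Maybe.just-injective (trans (sym eq) f-eq) , origin-eq

origin-invariant : ∀ es₀ → negatives es₀ ≡ 0 → ∀ e {l} → iterˡ e (flatEs es₀) ≡ just l →
  ∃ λ es → l ≡ flatEs es × origin (negatives es) es ≡ flatEs es₀
origin-invariant es₀ none zero    refl = es₀ , refl , trans (cong (λ k → origin k es₀) none) (origin₀-nonneg es₀ none)
origin-invariant es₀ none (suc e) eq with iterˡ e (flatEs es₀) in eqₑ | eq
... | just l′ | eq′ with origin-invariant es₀ none e eqₑ
... | es , refl , origin-es with f-step es eq′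
... | es′ , refl , origin-es′ = es′ , refl , trans origin-es′ origin-es

length-Dset : ∀ k l → length (Dset k l) ≡ length l
length-Dset k l = trans (length-zipWith _∨_ (marks (downBelowᵖ -[1+ 0 ]) (+ 0) l) (firstMarked dt k) (trans (length-marks _ (+ 0) l)
  (sym (trans (length-firstMarked dt k) (length-marks _ (+ 0) l))))) (length-marks _ (+ 0) l)
  where
  dt : List Bool
  dt = marks (downTouchᵖ (+ 0)) (+ 0) l

length-flipSet : ∀ k l → length (flipSet k l) ≡ length l
length-flipSet k l = trans (length-zipWith _∨_ (Uˡ l) (Dset k l) (trans (length-marks _ (+ 0) l) (sym (length-Dset k l)))) (length-marks _ (+ 0) l)

firstMarked-∷ : ∀ k e es → firstMarked (marks (downTouchᵖ (+ 0)) (+ 0) (flatEs (e ∷ es))) k ≡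
  firstMarked (marks (downTouchᵖ (+ 0)) (+ 0) (flatE e)) k ++ firstMarked (marks (downTouchᵖ (+ 0)) (+ 0) (flatEs es)) (k ∸ 1)
firstMarked-∷ k e es = trans (cong (λ m → firstMarked m k) (marks-flatEs-∷ _ (+ 0) e es))
  (trans (firstMarked-++ (marks _ (+ 0) (flatE e)) _ k)
    (cong (λ n → firstMarked (marks _ (+ 0) (flatE e)) k ++ firstMarked (marks _ (+ 0) (flatEs es)) (k ∸ n))
      (downTouches-flatE e)))

Dset-∷ : ∀ k e es → Dset k (flatEs (e ∷ es)) ≡ Dset k (flatE e) ++ Dset (k ∸ 1) (flatEs es)
Dset-∷ k e es = trans (cong₂ (List.zipWith _∨_) (marks-flatEs-∷ _ (+ 0) e es) (firstMarked-∷ k e es))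
  (zipWith-++ _∨_ (marks _ (+ 0) (flatE e)) _ (firstMarked (marks (downTouchᵖ (+ 0)) (+ 0) (flatE e)) k) _
    (trans (length-marks _ (+ 0) (flatE e)) (sym (trans (length-firstMarked (marks (downTouchᵖ (+ 0)) (+ 0) (flatE e)) k)
      (length-marks _ (+ 0) (flatE e))))))

flipSet-∷ : ∀ k e es → flipSet k (flatEs (e ∷ es)) ≡ flipSet k (flatE e) ++ flipSet (k ∸ 1) (flatEs es)
flipSet-∷ k e es = trans (cong₂ (List.zipWith _∨_) (marks-flatEs-∷ _ (+ 0) e es) (Dset-∷ k e es))
  (zipWith-++ _∨_ (Uˡ (flatE e)) _ (Dset k (flatE e)) _ (trans (length-marks _ (+ 0) (flatE e)) (sym (length-Dset k (flatE e)))))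

firstMarked-final : ∀ {A : Set} (l : List A) k → firstMarked (false ∷ blank l ++ true ∷ []) k ≡ false ∷ blank l ++ (0 <ᵇ k) ∷ []
firstMarked-final l zero    = cong (false ∷_) (firstMarked-blank l (true ∷ []) zero)
firstMarked-final l (suc k) = cong (false ∷_) (firstMarked-blank l (true ∷ []) (suc k))

firstMarked-initial : ∀ {A : Set} (l : List A) k → firstMarked (true ∷ blank l ++ false ∷ []) k ≡ (0 <ᵇ k) ∷ blank l ++ false ∷ []
firstMarked-initial l zero    = cong (false ∷_) (firstMarked-blank l (false ∷ []) zero)
firstMarked-initial l (suc k) = cong (true ∷_) (firstMarked-blank l (false ∷ []) k)

Dset-pos : ∀ k ts → Dset k (flatE (pos ts)) ≡ false ∷ blank (flatF ts) ++ (0 <ᵇ k) ∷ []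
Dset-pos k ts = begin
  Dset k (flatE (pos ts))
    ≡⟨ cong₂ (List.zipWith _∨_) (downBelow₋₁-pos ts) (trans (cong (λ m → firstMarked m k) (downTouch-pos ts)) (firstMarked-final (flatF ts) k)) ⟩
  List.zipWith _∨_ (false ∷ blank (flatF ts) ++ false ∷ []) (false ∷ blank (flatF ts) ++ (0 <ᵇ k) ∷ [])
    ≡⟨ zipWith-wrap _∨_ false (blank (flatF ts)) false false (blank (flatF ts)) (0 <ᵇ k) refl ⟩
  false ∷ List.zipWith _∨_ (blank (flatF ts)) (blank (flatF ts)) ++ (0 <ᵇ k) ∷ []
    ≡⟨ cong (λ l → false ∷ l ++ (0 <ᵇ k) ∷ []) (blank-∨-blank (flatF ts)) ⟩
  false ∷ blank (flatF ts) ++ (0 <ᵇ k) ∷ [] ∎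
  where open ≡-Reasoning

Dset-neg : ∀ k ts → Dset k (flatE (neg ts)) ≡ (0 <ᵇ k) ∷ flatF ts ++ false ∷ []
Dset-neg k ts = begin
  Dset k (flatE (neg ts))
    ≡⟨ cong₂ (List.zipWith _∨_) (downBelow₋₁-neg ts) (trans (cong (λ m → firstMarked m k) (downTouch-neg ts)) (firstMarked-initial (flatF ts) k)) ⟩
  List.zipWith _∨_ (false ∷ flatF ts ++ false ∷ []) ((0 <ᵇ k) ∷ blank (flatF ts) ++ false ∷ [])
    ≡⟨ zipWith-wrap _∨_ false (flatF ts) false (0 <ᵇ k) (blank (flatF ts)) false (sym (length-blank (flatF ts))) ⟩
  (0 <ᵇ k) ∷ List.zipWith _∨_ (flatF ts) (blank (flatF ts)) ++ false ∷ []
    ≡⟨ cong (λ l → (0 <ᵇ k) ∷ l ++ false ∷ []) (∨-blank (flatF ts)) ⟩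
  (0 <ᵇ k) ∷ flatF ts ++ false ∷ [] ∎
  where open ≡-Reasoning

flipSet-pos : ∀ k ts → flipSet k (flatE (pos ts)) ≡ false ∷ blank (flatF ts) ++ (0 <ᵇ k) ∷ []
flipSet-pos k ts = begin
  flipSet k (flatE (pos ts))
    ≡⟨ cong₂ (List.zipWith _∨_) (upBelow-pos ts) (Dset-pos k ts) ⟩
  List.zipWith _∨_ (false ∷ blank (flatF ts) ++ false ∷ []) (false ∷ blank (flatF ts) ++ (0 <ᵇ k) ∷ [])
    ≡⟨ zipWith-wrap _∨_ false (blank (flatF ts)) false false (blank (flatF ts)) (0 <ᵇ k) refl ⟩
  false ∷ List.zipWith _∨_ (blank (flatF ts)) (blank (flatF ts)) ++ (0 <ᵇ k) ∷ []
    ≡⟨ cong (λ l → false ∷ l ++ (0 <ᵇ k) ∷ []) (blank-∨-blank (flatF ts)) ⟩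
  false ∷ blank (flatF ts) ++ (0 <ᵇ k) ∷ [] ∎
  where open ≡-Reasoning

flipSet-neg : ∀ k ts → flipSet k (flatE (neg ts)) ≡ (0 <ᵇ k) ∷ map (λ _ → true) (flatF ts) ++ true ∷ []
flipSet-neg k ts = begin
  flipSet k (flatE (neg ts))
    ≡⟨ cong₂ (List.zipWith _∨_) (upBelow-neg ts) (Dset-neg k ts) ⟩
  List.zipWith _∨_ (false ∷ map not (flatF ts) ++ true ∷ []) ((0 <ᵇ k) ∷ flatF ts ++ false ∷ [])
    ≡⟨ zipWith-wrap _∨_ false (map not (flatF ts)) true (0 <ᵇ k) (flatF ts) false (List.length-map not (flatF ts)) ⟩
  (0 <ᵇ k) ∷ List.zipWith _∨_ (map not (flatF ts)) (flatF ts) ++ true ∷ []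
    ≡⟨ cong (λ l → (0 <ᵇ k) ∷ l ++ true ∷ []) (not-∨ (flatF ts)) ⟩
  (0 <ᵇ k) ∷ map (λ _ → true) (flatF ts) ++ true ∷ [] ∎
  where open ≡-Reasoning

xor-flipSet-flatE : ∀ k e → List.zipWith _xor_ (flatE e) (flipSet k (flatE e)) ≡ flipped (0 <ᵇ k) e
xor-flipSet-flatE k (pos ts) = begin
  List.zipWith _xor_ (flatE (pos ts)) (flipSet k (flatE (pos ts)))
    ≡⟨ cong (List.zipWith _xor_ (flatE (pos ts))) (flipSet-pos k ts) ⟩
  List.zipWith _xor_ (true ∷ flatF ts ++ false ∷ []) (false ∷ blank (flatF ts) ++ (0 <ᵇ k) ∷ [])
    ≡⟨ zipWith-wrap _xor_ true (flatF ts) false false (blank (flatF ts)) (0 <ᵇ k) (sym (length-blank (flatF ts))) ⟩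
  true ∷ List.zipWith _xor_ (flatF ts) (blank (flatF ts)) ++ (0 <ᵇ k) ∷ []
    ≡⟨ cong (λ l → true ∷ l ++ (0 <ᵇ k) ∷ []) (xor-blank (flatF ts)) ⟩
  true ∷ flatF ts ++ (0 <ᵇ k) ∷ []
    ≡⟨ closing (0 <ᵇ k) ⟩
  flipped (0 <ᵇ k) (pos ts) ∎
  where
  open ≡-Reasoning
  closing : ∀ c → true ∷ flatF ts ++ c ∷ [] ≡ flipped c (pos ts)
  closing true  = refl
  closing false = refl
xor-flipSet-flatE k (neg ts) = begin
  List.zipWith _xor_ (flatE (neg ts)) (flipSet k (flatE (neg ts)))
    ≡⟨ cong₂ (List.zipWith _xor_) (flatE-neg ts) (flipSet-neg k ts) ⟩
  List.zipWith _xor_ (false ∷ map not (flatF ts) ++ true ∷ []) ((0 <ᵇ k) ∷ map (λ _ → true) (flatF ts) ++ true ∷ [])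
    ≡⟨ zipWith-wrap _xor_ false (map not (flatF ts)) true (0 <ᵇ k) (map (λ _ → true) (flatF ts)) true
         (trans (List.length-map not (flatF ts)) (sym (List.length-map _ (flatF ts)))) ⟩
  (0 <ᵇ k) ∷ List.zipWith _xor_ (map not (flatF ts)) (map (λ _ → true) (flatF ts)) ++ false ∷ []
    ≡⟨ cong (λ l → (0 <ᵇ k) ∷ l ++ false ∷ []) (not-xor-true (flatF ts)) ⟩
  (0 <ᵇ k) ∷ flatF ts ++ false ∷ []
    ≡⟨ opening (0 <ᵇ k) ⟩
  flipped (0 <ᵇ k) (neg ts) ∎
  where
  open ≡-Reasoning
  opening : ∀ c → c ∷ flatF ts ++ false ∷ [] ≡ flipped c (neg ts)
  opening true  = refl
  opening false = refl

origin-flipSet : ∀ k es → List.zipWith _xor_ (flatEs es) (flipSet k (flatEs es)) ≡ origin k es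
origin-flipSet k []       = refl
origin-flipSet k (e ∷ es) = begin
  List.zipWith _xor_ (flatE e ++ flatEs es) (flipSet k (flatEs (e ∷ es)))
    ≡⟨ cong (List.zipWith _xor_ (flatE e ++ flatEs es)) (flipSet-∷ k e es) ⟩
  List.zipWith _xor_ (flatE e ++ flatEs es) (flipSet k (flatE e) ++ flipSet (k ∸ 1) (flatEs es))
    ≡⟨ zipWith-++ _xor_ (flatE e) (flatEs es) (flipSet k (flatE e)) _ (sym (length-flipSet k (flatE e))) ⟩
  List.zipWith _xor_ (flatE e) (flipSet k (flatE e)) ++ List.zipWith _xor_ (flatEs es) (flipSet (k ∸ 1) (flatEs es))
    ≡⟨ cong₂ _++_ (xor-flipSet-flatE k e) (origin-flipSet (k ∸ 1) es) ⟩
  flipped (0 <ᵇ k) e ++ origin (k ∸ 1) es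
    ≡⟨ origin-∷ k ⟩
  origin k (e ∷ es) ∎
  where
  open ≡-Reasoning
  origin-∷ : ∀ k → flipped (0 <ᵇ k) e ++ origin (k ∸ 1) es ≡ origin k (e ∷ es)
  origin-∷ zero    = refl
  origin-∷ (suc k) = refl

trues-Dset : ∀ k es → k ≤ length es → trues (Dset k (flatEs es)) ≡ sumOver innerDowns es + k
trues-Dset zero    []       _  = refl
trues-Dset k       (e ∷ es) le = begin
  trues (Dset k (flatEs (e ∷ es)))                                   ≡⟨ cong trues (Dset-∷ k e es) ⟩
  trues (Dset k (flatE e) ++ Dset (k ∸ 1) (flatEs es))               ≡⟨ trues-++ (Dset k (flatE e)) _ ⟩
  trues (Dset k (flatE e)) + trues (Dset (k ∸ 1) (flatEs es))        ≡⟨ cong₂ _+_ (local e) (trues-Dset (k ∸ 1) es (pred-≤ k le)) ⟩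
  (innerDowns e + trues ((0 <ᵇ k) ∷ [])) + (sumOver innerDowns es + (k ∸ 1)) ≡⟨ regroup k ⟩
  sumOver innerDowns (e ∷ es) + k                                     ∎
  where
  open ≡-Reasoning
  local : ∀ e → trues (Dset k (flatE e)) ≡ innerDowns e + trues ((0 <ᵇ k) ∷ [])
  local (pos ts) = trans (cong trues (Dset-pos k ts)) (trues-wrap-blank false (flatF ts) (0 <ᵇ k))
  local (neg ts) = trans (cong trues (Dset-neg k ts)) (trans (trues-wrap (0 <ᵇ k) (flatF ts) false) (cong (λ n → trues (flatF ts) + n) (lead k)))
    where
    lead : ∀ k → trues ((0 <ᵇ k) ∷ false ∷ []) ≡ trues ((0 <ᵇ k) ∷ [])
    lead zero    = refl
    lead (suc k) = refl
  pred-≤ : ∀ k → k ≤ suc (length es) → k ∸ 1 ≤ length es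
  pred-≤ zero    _       = z≤n
  pred-≤ (suc k) (s≤s p) = p
  regroup : ∀ k → (innerDowns e + trues ((0 <ᵇ k) ∷ [])) + (sumOver innerDowns es + (k ∸ 1)) ≡ sumOver innerDowns (e ∷ es) + k
  regroup zero    = arith₀ (innerDowns e) (sumOver innerDowns es)
    where
    arith₀ : ∀ a b → (a + 0) + (b + 0) ≡ (a + b) + 0
    arith₀ = solve-∀
  regroup (suc k) = arith₁ (innerDowns e) (sumOver innerDowns es) k
    where
    arith₁ : ∀ a b k → (a + 1) + (b + k) ≡ (a + b) + suc k
    arith₁ = solve-∀

trues-Dˡ : ∀ es → trues (Dˡ (flatEs es)) ≡ sumOver belowCount es
trues-Dˡ es = begin
  trues (Dset (d₀ˡ (flatEs es)) (flatEs es))         ≡⟨ cong (λ k → trues (Dset k (flatEs es))) (d₀-flatEs es) ⟩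
  trues (Dset (negatives es) (flatEs es))            ≡⟨ trues-Dset (negatives es) es negatives≤length ⟩
  sumOver innerDowns es + negatives es               ≡⟨ sym (sumOver-+ innerDowns isNeg es) ⟩
  sumOver belowCount es                              ∎
  where
  open ≡-Reasoning
  negatives≤length : negatives es ≤ length es
  negatives≤length = subst (negatives es ≤_) (sym (length≡positives+negatives es)) (ℕ.m≤n+m (negatives es) (positives es))

∣downBelow₀∣ : ∀ {n} (x : Path n) es → toList x ≡ flatEs es → ∣ downBelow (+ 0) x ∣ ≡ sumOver belowCount es
∣downBelow₀∣ x es eq = trans (∣tabulate-marks∣ (downBelowᵖ (+ 0)) (+ 0) x)
  (trans (cong (λ l → trues (marks (downBelowᵖ (+ 0)) (+ 0) l)) eq) (downsBelow₀-flatEs es))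

∣Ux∣ : ∀ {n} (x : Path n) es → toList x ≡ flatEs es → ∣ Ux x ∣ ≡ sumOver belowCount es
∣Ux∣ x es eq = trans (∣tabulate-marks∣ (upBelowᵖ (+ 0)) (+ 0) x) (trans (cong (λ l → trues (Uˡ l)) eq) (trues-Uˡ es))

∣Dx∣ : ∀ {n} (x : Path n) es → toList x ≡ flatEs es → ∣ Dx x ∣ ≡ sumOver belowCount es
∣Dx∣ x es eq = trans (∣∣≡trues (Dx x)) (trans (cong trues (trans (toList-Dx x) (cong Dˡ eq))) (trues-Dˡ es))

diffPos≡Ux∪Dx : ∀ {n} (x₀ x : Path n) es → toList x ≡ flatEs es → toList x₀ ≡ origin (negatives es) es →
  diffPos x₀ x ≡ Ux x ∪ Dx x
diffPos≡Ux∪Dx x₀ x es x-eq x₀-eq = trans (sym (Vec.cast-is-id refl (diffPos x₀ x))) (Vec.toList-injective refl _ _ (begin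
  toList (diffPos x₀ x)                                      ≡⟨ toList-zipWith _xor_ x₀ x ⟩
  List.zipWith _xor_ (toList x₀) (toList x)                  ≡⟨ cong₂ (List.zipWith _xor_) x₀-eq x-eq ⟩
  List.zipWith _xor_ (origin (negatives es) es) (flatEs es)  ≡⟨ cong (λ o → List.zipWith _xor_ o (flatEs es)) (sym (origin-flipSet (negatives es) es)) ⟩
  List.zipWith _xor_ (List.zipWith _xor_ (flatEs es) S) (flatEs es) ≡⟨ xor-cancel (flatEs es) S (sym (length-flipSet (negatives es) (flatEs es))) ⟩
  S                                                          ≡⟨ cong (λ k → flipSet k (flatEs es)) (sym (d₀-flatEs es)) ⟩
  flipSet (d₀ˡ (flatEs es)) (flatEs es)                      ≡⟨ cong (λ l → flipSet (d₀ˡ l) l) (sym x-eq) ⟩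
  flipSet (d₀ˡ (toList x)) (toList x)                        ≡⟨ sym (trans (toList-zipWith _∨_ (Ux x) (Dx x)) (cong₂ (List.zipWith _∨_) (toList-Ux x) (toList-Dx x))) ⟩
  toList (Ux x ∪ Dx x)                                       ∎))
  where
  open ≡-Reasoning
  S : List Bool
  S = flipSet (negatives es) (flatEs es)

lemma11 : (k : ℕ) → 1 ≤ k → (e : ℕ) → e ≤ k →
    (x : Path (2 * k)) → InD k e x →
    (x0 : Path (2 * k)) → InD k 0 x0 → iterM e f x0 ≡ just x →
    (diffPos x0 x ≡ Ux x ∪ Dx x) × (∣ Ux x ∣ ≡ e) × (∣ Dx x ∣ ≡ e)
lemma11 k _ e _ x (_ , below) x0 (ups₀ , below₀) iterate
  with es₀ , x0-eq ← excursionsOf _ (toList x0) ℕ.≤-refl (balanced k x0 ups₀)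
  with es , x-eq , origin-eq ← origin-invariant es₀ (negatives-none es₀ (trans (sym (∣downBelow₀∣ x0 es₀ (sym x0-eq))) below₀)) e
         (trans (cong (iterˡ e) x0-eq) (trans (sym (toList-iterM e x0)) (cong (Maybe.map toList) iterate)))
  = diffPos≡Ux∪Dx x0 x es x-eq (trans (sym x0-eq) (sym origin-eq))
  , trans (∣Ux∣ x es x-eq) (trans (sym (∣downBelow₀∣ x es x-eq)) below)
  , trans (∣Dx∣ x es x-eq) (trans (sym (∣downBelow₀∣ x es x-eq)) below)
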